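{- For every integer $a\ge 2$, $$\beta_b(C(2a;1,a))=\begin{cases}\alpha(C(2a;1,a))=a, & \text{if } a \text{ is odd},\\ \alpha(C(2a;1,a))=a-1, & \text{if } a=2^p \text{ for some integer } p\ge 1,\\ a, & \text{otherwise.}\end{cases}$$
   Context: For integers $n\ge 3$ and $1\le a\le\lfloor n/2\rfloor$, the circulant graph $C(n;1,a)$ has vertex set $\{v_0,\dots,v_{n-1}\}$ and edges $v_iv_{i+1}$ and $v_iv_{i+a}$, subscripts modulo $n$. For a connected graph $G$, a broadcast is a function $f:V(G)\to\{0,\dots,\mathrm{diam}(G)\}$ with $f(v)\le e(v)$ (eccentricity) for all $v$; $V_f^+=\{v:f(v)>0\}$. $f$ is independent if $d(u,v)>\max\{f(u),f(v)\}$ for all distinct $u,v\in V_f^+$. The cost is $\sigma(f)=\sum_v f(v)$, and $\beta_b(G)$ is the maximum cost of an independent broadcast on $G$. $\alpha(G)$ denotes the independence number. -}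

module Defs where

open import Data.Nat using (ℕ; zero; suc; _+_; _*_; _<_; _≤_; _⊔_)
open import Data.Fin using (Fin; toℕ)
open import Data.Fin.Subset using (Subset; _∈_; ∣_∣)
open import Data.List using (List; map; allFin)
open import Data.Nat.ListAction using (sum)
open import Data.Product using (Σ; ∃; _×_; _,_)
open import Data.Sum using (_⊎_)
open import Relation.Nullary using (¬_)
open import Relation.Binary.PropositionalEquality using (_≡_; _≢_)

Rel : ℕ → Set₁
Rel n = Fin n → Fin n → Set

-- "v is v_{i+s} where u = v_i", subscripts modulo n (for 0 ≤ s ≤ n).
Shift : (n s : ℕ) → Fin n → Fin n → Set
Shift n s u v = (toℕ v ≡ toℕ u + s) ⊎ (toℕ v + n ≡ toℕ u + s)

Circ : (n a : ℕ) → Rel n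
Circ n a u v = Shift n 1 u v ⊎ Shift n 1 v u ⊎ Shift n a u v ⊎ Shift n a v u

data Walk {n : ℕ} (G : Rel n) : Fin n → Fin n → ℕ → Set where
  here : ∀ {u} → Walk G u u 0
  step : ∀ {u w v k} → G u w → Walk G w v k → Walk G u v (suc k)

Dist : {n : ℕ} → Rel n → Fin n → Fin n → ℕ → Set
Dist G u v d = Walk G u v d × (∀ m → m < d → ¬ Walk G u v m)

-- f(v) ≤ e(v) (eccentricity = max_u d(v,u)).
LeEcc : {n : ℕ} → Rel n → Fin n → ℕ → Set
LeEcc G v k = ∃ λ u → ∃ λ d → Dist G v u d × k ≤ d

-- Broadcast: f(v) ≤ e(v) for all v (this also gives f(v) ≤ diam G).
IsBroadcast : {n : ℕ} → Rel n → (Fin n → ℕ) → Set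
IsBroadcast G f = ∀ v → LeEcc G v (f v)

IsIndependentBroadcast : {n : ℕ} → Rel n → (Fin n → ℕ) → Set
IsIndependentBroadcast G f =
  IsBroadcast G f ×
  (∀ u v → u ≢ v → 0 < f u → 0 < f v → ∀ d → Dist G u v d → f u ⊔ f v < d)

cost : {n : ℕ} → (Fin n → ℕ) → ℕ
cost {n} f = sum (map f (allFin n))

BroadcastIndepNumber : {n : ℕ} → Rel n → ℕ → Set
BroadcastIndepNumber {n} G k =
  (Σ (Fin n → ℕ) λ f → IsIndependentBroadcast G f × cost f ≡ k) ×
  (∀ f → IsIndependentBroadcast G f → cost f ≤ k)

IsIndependentSet : {n : ℕ} → Rel n → Subset n → Set
IsIndependentSet G S = ∀ u v → u ∈ S → v ∈ S → ¬ G u v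

IndepNumber : {n : ℕ} → Rel n → ℕ → Set
IndepNumber {n} G k =
  (Σ (Subset n) λ S → IsIndependentSet G S × ∣ S ∣ ≡ k) ×
  (∀ S → IsIndependentSet G S → ∣ S ∣ ≤ k)

-- From v, j unit steps reach v + j, and one more a-step reaches v + j + a; these are the
-- two vertices congruent to v + j modulo a, so any vertex ≡ v + j (mod a) is within distance j + 1.
-- Hence in an independent broadcast f the residues v, v + 1, …, v + f(v) − 1 (mod a) claimed by the
-- broadcasting vertices are pairwise disjoint, and σ(f) ≤ a.  The indicator of an independent set is
-- an independent broadcast, so α ≤ β_b ≤ a.
--
-- If σ(f) = a, every residue is claimed, and the claim following v's must start exactly at v + f(v) + a
-- (at v + f(v) it would be too close) with a value at most f(v).  So all values equal one H < a and the
-- broadcasters are v₀ + k(H + a); whenever a ∣ kH this vertex is congruent to v₀ mod a, hence equal to v₀,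
-- i.e. 2a ∣ k(H + a).  For a = 2^p this forces 2^p ∣ H, a contradiction, so β_b ≤ a − 1 there.
--
-- The lower bounds are explicit: the even vertices for odd a; the even vertices below a together with
-- the odd ones in [a, 2a − 1) for even a; and, when a = mH with m ≥ 3 odd, the value H on the m multiples
-- of 2H.  The last broadcast is independent because writing the end point of a walk of length L ≤ H as
-- x + s + c·a (mod 2a) with |s| + c ≤ L, and x, y multiples of 2H, forces x = y as m is odd.

module Submission where

open import Defs
open import Data.Nat
open import Data.Nat.Properties
open import Algebra.Properties.CommutativeSemigroup +-commutativeSemigroup using (interchange)
open import Data.Nat.Induction using (<-rec)
open import Data.Nat.DivMod
open import Data.Nat.Divisibility
  using (_∣_; _∣?_; divides; _∣0; 1∣_; n∣n; m∣m*n; ∣n⇒∣m*n; ∣m∣n⇒∣m+n; ∣m+n∣m⇒∣n; ∣⇒≤; m%n≡0⇒n∣m;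
         *-monoʳ-∣; *-cancelˡ-∣)
open import Data.Bool using (true; false; if_then_else_)
open import Data.Fin as Fin using (Fin; toℕ; fromℕ<)
open import Data.Fin.Properties using (any?; injective⇒≤; fromℕ<-injective; toℕ-fromℕ<; toℕ-injective; toℕ<n)
open import Data.Fin.Subset using (Subset; ∣_∣; _∈_)
open import Data.Vec using ([]; _∷_; lookup; tabulate)
open import Data.Vec.Properties using (lookup⇒[]=; []=⇒lookup; lookup∘tabulate)
open import Data.List using (List; length; map; allFin)
import Data.List as List
open import Data.List.Properties using (map-tabulate; map-cong; length-++; length-applyUpTo)
import Data.List.Membership.Propositional as List
open import Data.List.Membership.DecPropositional _≟_ using (_∈?_)
open import Data.List.Membership.Propositional.Properties using (∈-lookup; ∈-map⁻; ∈-concat⁻′; ∈-applyUpTo⁻)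
import Data.List.Relation.Unary.Unique.Propositional.Properties as Unique
import Data.List.Relation.Unary.AllPairs as AllPairs
import Data.List.Relation.Unary.AllPairs.Properties as AllPairs
open import Data.List.Relation.Unary.All as All using (All)
open import Data.List.Relation.Unary.AllPairs using (_∷_)
open import Data.List.Relation.Unary.Unique.Propositional using (Unique)
open import Data.List.Relation.Binary.Disjoint.Propositional using (Disjoint)
open import Data.Nat.ListAction using (sum)
open import Data.Product using (∃; _×_; _,_; proj₁; proj₂)
open import Data.Sum using (_⊎_; inj₁; inj₂; [_,_]′)
open import Data.Empty using (⊥; ⊥-elim)

open import Data.Parity.Base as ℙ using (Parity; 0ℙ; 1ℙ; _⁻¹)
open import Data.Parity.Properties using (+-homo-+; *-homo-*; suc-homo-⁻¹; p≢p⁻¹)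
  renaming (_≟_ to _≟ℙ_; +-identityʳ to +ℙ-identityʳ; +-comm to +ℙ-comm)
open import Function using (_∘_; id)
open import Relation.Nullary using (¬_; Dec; yes; no; does)
open import Relation.Nullary.Decidable using (_⊎-dec_; _×-dec_)
open import Relation.Binary.PropositionalEquality
open import Relation.Binary.Definitions using (tri<; tri≈; tri>)

-- Walks and independent broadcasts in an arbitrary graph

module Walks {n : ℕ} (G : Rel n) where

  _++ʷ_ : ∀ {u v w k m} → Walk G u v k → Walk G v w m → Walk G u w (k + m)
  here ++ʷ q = q
  step e p ++ʷ q = step e (p ++ʷ q)

  walk-0⇒≡ : ∀ {u v} → Walk G u v 0 → u ≡ v
  walk-0⇒≡ here = refl

  walk-1⇒edge : ∀ {u v} → Walk G u v 1 → G u v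
  walk-1⇒edge (step e here) = e

  dist≤length : ∀ {u v d L} → Dist G u v d → Walk G u v L → d ≤ L
  dist≤length {d = d} {L} (_ , shortest) p with L <? d
  ... | yes L<d = ⊥-elim (shortest L L<d p)
  ... | no L≮d = ≮⇒≥ L≮d

  module _ (G? : ∀ u v → Dec (G u v)) where

    walk? : ∀ u v k → Dec (Walk G u v k)
    walk? u v zero with u Fin.≟ v
    ... | yes refl = yes here
    ... | no u≢v = no (u≢v ∘ walk-0⇒≡)
    walk? u v (suc k) with any? (λ w → G? u w ×-dec walk? w v k)
    ... | yes (w , e , p) = yes (step e p)
    ... | no none = no λ { (step e p) → none (_ , e , p) }

    shortest-walk : ∀ {u v} L → Walk G u v L → ∃ λ d → Dist G u v d × d ≤ L
    shortest-walk {u} {v} = <-rec _ λ L shorter p → minimal (anyUpTo? (walk? u v) L) p shorter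
      where
        minimal : ∀ {L} → Dec (∃ λ m → m < L × Walk G u v m) → Walk G u v L →
               (∀ {m} → m < L → Walk G u v m → ∃ λ d → Dist G u v d × d ≤ m) →
               ∃ λ d → Dist G u v d × d ≤ L
        minimal (yes (m , m<L , q)) _ shorter with shorter m<L q
        ... | d , D , d≤m = d , D , ≤-trans d≤m (<⇒≤ m<L)
        minimal {L} (no none) p _ = L , (p , λ m m<L q → none (m , m<L , q)) , ≤-refl

module IndependentBroadcastProperties {n : ℕ} {G : Rel n} (G? : ∀ u v → Dec (G u v))
                                      {f : Fin n → ℕ} (ib : IsIndependentBroadcast G f) where
  open Walks G

  <-walk-length : ∀ {v w L} → v ≢ w → 0 < f v → 0 < f w → Walk G v w L → f v < L
  <-walk-length v≢w 0<fv 0<fw p with shortest-walk G? _ p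
  ... | d , D , d≤L = ≤-trans (s≤s (m≤m⊔n _ _)) (≤-trans (proj₂ ib _ _ v≢w 0<fv 0<fw d D) d≤L)

  ≤-radius : ∀ v B → (∀ u → ∃ λ L → L ≤ B × Walk G v u L) → f v ≤ B
  ≤-radius v B within with proj₁ ib v
  ... | u , d , D , fv≤d with within u
  ...   | L , L≤B , p = ≤-trans fv≤d (≤-trans (dist≤length D p) L≤B)

-- Finite sums, costs and independent sets

∑< : ℕ → (ℕ → ℕ) → ℕ
∑< zero g = 0
∑< (suc n) g = g 0 + ∑< n (g ∘ suc)

∑<-+ : ∀ m n g → ∑< (m + n) g ≡ ∑< m g + ∑< n (g ∘ (m +_))
∑<-+ zero n g = refl
∑<-+ (suc m) n g = trans (cong (g 0 +_) (∑<-+ m n (g ∘ suc))) (sym (+-assoc (g 0) _ _))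

∑<-cong : ∀ n {g h} → (∀ i → i < n → g i ≡ h i) → ∑< n g ≡ ∑< n h
∑<-cong zero _ = refl
∑<-cong (suc n) g≗h = cong₂ _+_ (g≗h 0 (s≤s z≤n)) (∑<-cong n λ i i<n → g≗h (suc i) (s≤s i<n))

∑<-distrib : ∀ n g h → ∑< n (λ i → g i + h i) ≡ ∑< n g + ∑< n h
∑<-distrib zero g h = refl
∑<-distrib (suc n) g h = trans (cong (g 0 + h 0 +_) (∑<-distrib n (g ∘ suc) (h ∘ suc))) (interchange (g 0) (h 0) _ _)

∑<-const : ∀ n c → ∑< n (λ _ → c) ≡ n * c
∑<-const zero c = refl
∑<-const (suc n) c = cong (c +_) (∑<-const n c)

∑<-halves : ∀ n g → ∑< (n + n) g ≡ ∑< n (λ i → g i + g (n + i))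
∑<-halves n g = trans (∑<-+ n n g) (sym (∑<-distrib n g (g ∘ (n +_))))

∑<-*ʳ : ∀ n g c → ∑< n (λ i → g i * c) ≡ ∑< n g * c
∑<-*ʳ zero g c = refl
∑<-*ʳ (suc n) g c = trans (cong (g 0 * c +_) (∑<-*ʳ n (g ∘ suc) c)) (sym (*-distribʳ-+ c (g 0) _))

χ : ∀ {A : Set} → Dec A → ℕ
χ d = if does d then 1 else 0

χ-one : ∀ {A B : Set} (d : Dec A) (e : Dec B) → (A → ¬ B) → (¬ A → B) → χ d + χ e ≡ 1
χ-one (yes a) (yes b) a⇒¬b _ = ⊥-elim (a⇒¬b a b)
χ-one (yes _) (no _) _ _ = refl
χ-one (no _) (yes _) _ _ = refl
χ-one (no ¬a) (no ¬b) _ ¬a⇒b = ⊥-elim (¬b (¬a⇒b ¬a))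

χ-none : ∀ {A B : Set} (d : Dec A) (e : Dec B) → ¬ A → ¬ B → χ d + χ e ≡ 0
χ-none (yes a) _ ¬a _ = ⊥-elim (¬a a)
χ-none (no _) (yes b) _ ¬b = ⊥-elim (¬b b)
χ-none (no _) (no _) _ _ = refl

χ-yes : ∀ {A : Set} (d : Dec A) → A → χ d ≡ 1
χ-yes (yes _) _ = refl
χ-yes (no ¬a) a = ⊥-elim (¬a a)

χ-no : ∀ {A : Set} (d : Dec A) → ¬ A → χ d ≡ 0
χ-no (yes a) ¬a = ⊥-elim (¬a a)
χ-no (no _) _ = refl

χ-cong : ∀ {A B : Set} (d : Dec A) (e : Dec B) → (A → B) → (B → A) → χ d ≡ χ e
χ-cong (yes _) (yes _) _ _ = refl
χ-cong (yes a) (no ¬b) A⇒B _ = ⊥-elim (¬b (A⇒B a))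
χ-cong (no ¬a) (yes b) _ B⇒A = ⊥-elim (¬a (B⇒A b))
χ-cong (no _) (no _) _ _ = refl

∑<-multiples : ∀ d m → 0 < d → ∑< (m * d) (λ x → χ (d ∣? x)) ≡ m
∑<-multiples d zero _ = refl
∑<-multiples d@(suc d′) (suc m) 0<d = begin
  ∑< (d + m * d) multiple                          ≡⟨ ∑<-+ d (m * d) multiple ⟩
  ∑< d multiple + ∑< (m * d) (multiple ∘ (d +_))   ≡⟨ cong₂ _+_ one-per-period (∑<-cong (m * d) λ x _ → periodic x) ⟩
  1 + ∑< (m * d) multiple                          ≡⟨ cong suc (∑<-multiples d m 0<d) ⟩
  suc m                                            ∎
  where
    open ≡-Reasoning
    multiple : ℕ → ℕ
    multiple x = χ (d ∣? x)
    periodic : ∀ x → multiple (d + x) ≡ multiple x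
    periodic x = χ-cong (d ∣? (d + x)) (d ∣? x) (λ d∣d+x → ∣m+n∣m⇒∣n d∣d+x n∣n) (∣m∣n⇒∣m+n n∣n)
    one-per-period : ∑< d multiple ≡ 1
    one-per-period = cong₂ _+_ (χ-yes (d ∣? 0) (d ∣0)) (begin
      ∑< d′ (multiple ∘ suc)   ≡⟨ ∑<-cong d′ (λ i i<d′ → χ-no (d ∣? suc i) λ d∣1+i → <⇒≱ (s≤s i<d′) (∣⇒≤ d∣1+i)) ⟩
      ∑< d′ (λ _ → 0)          ≡⟨ ∑<-const d′ 0 ⟩
      d′ * 0                   ≡⟨ *-zeroʳ d′ ⟩
      0                        ∎)

cost-suc : ∀ {n} (f : Fin (suc n) → ℕ) → cost f ≡ f Fin.zero + cost (f ∘ Fin.suc)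
cost-suc {n} f = cong (f Fin.zero +_) (cong sum (begin
    map f (List.tabulate Fin.suc)   ≡⟨ map-tabulate Fin.suc f ⟩
    List.tabulate (f ∘ Fin.suc)     ≡⟨ sym (map-tabulate id (f ∘ Fin.suc)) ⟩
    map (f ∘ Fin.suc) (allFin n)    ∎))
  where open ≡-Reasoning

cost-cong : ∀ {n} {f g : Fin n → ℕ} → (∀ x → f x ≡ g x) → cost f ≡ cost g
cost-cong {n} f≗g = cong sum (map-cong f≗g (allFin n))

cost-toℕ : ∀ n (g : ℕ → ℕ) → cost (g ∘ toℕ {n}) ≡ ∑< n g
cost-toℕ zero g = refl
cost-toℕ (suc n) g = trans (cost-suc {n} (g ∘ toℕ)) (cong (g 0 +_) (cost-toℕ n (g ∘ suc)))

indicator : ∀ {n} → Subset n → Fin n → ℕ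
indicator S x = if lookup S x then 1 else 0

cost-indicator : ∀ {n} (S : Subset n) → cost (indicator S) ≡ ∣ S ∣
cost-indicator [] = refl
cost-indicator (true ∷ S) = trans (cost-suc (indicator (true ∷ S))) (cong suc (cost-indicator S))
cost-indicator (false ∷ S) = trans (cost-suc (indicator (false ∷ S))) (cost-indicator S)

module _ {P : ℕ → Set} (P? : ∀ x → Dec (P x)) where

  subset : ∀ n → Subset n
  subset n = tabulate (does ∘ P? ∘ toℕ)

  ∈-subset⁻ : ∀ {n} {x : Fin n} → x ∈ subset n → P (toℕ x)
  ∈-subset⁻ {x = x} x∈ =
    witness (P? (toℕ x)) (trans (sym (lookup∘tabulate (does ∘ P? ∘ toℕ) x)) ([]=⇒lookup x∈))
    where
      witness : ∀ {A : Set} (d : Dec A) → does d ≡ true → A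
      witness (yes a) _ = a

  ∣subset∣ : ∀ n → ∣ subset n ∣ ≡ ∑< n (χ ∘ P?)
  ∣subset∣ n = begin
    ∣ subset n ∣                   ≡⟨ sym (cost-indicator (subset n)) ⟩
    cost (indicator (subset n))    ≡⟨ cost-cong {n} (cong (λ t → if t then 1 else 0) ∘ lookup∘tabulate (does ∘ P? ∘ toℕ)) ⟩
    cost {n} (χ ∘ P? ∘ toℕ)        ≡⟨ cost-toℕ n (χ ∘ P?) ⟩
    ∑< n (χ ∘ P?)                  ∎
    where open ≡-Reasoning

module _ {n : ℕ} {G : Rel n} where
  open Walks G

  indicator-independent : (∀ v → ∃ λ u → u ≢ v × G v u) →
                          ∀ S → IsIndependentSet G S → IsIndependentBroadcast G (indicator S)
  indicator-independent neighbour S indep = broadcast , independent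
    where
      broadcast : IsBroadcast G (indicator S)
      broadcast v with lookup S v
      ... | false = v , 0 , (here , λ _ ()) , z≤n
      ... | true with neighbour v
      ...   | u , u≢v , e = u , 1 , (step e here , shorter) , ≤-refl
        where
          shorter : ∀ m → m < 1 → ¬ Walk G v u m
          shorter zero _ p = u≢v (sym (walk-0⇒≡ p))
          shorter (suc _) (s≤s ()) _
      member : ∀ v → 0 < indicator S v → v ∈ S
      member v 0<Sv with lookup S v in Sv≡
      ... | true = lookup⇒[]= v S Sv≡
      ... | false = ⊥-elim (n≮0 0<Sv)
      indicator≤1 : ∀ v → indicator S v ≤ 1
      indicator≤1 v with lookup S v
      ... | true = ≤-refl
      ... | false = z≤n
      independent : ∀ u v → u ≢ v → 0 < indicator S u → 0 < indicator S v →
                    ∀ d → Dist G u v d → indicator S u ⊔ indicator S v < d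
      independent u v u≢v 0<Su 0<Sv d (p , _) =
        ≤-<-trans (⊔-lub (indicator≤1 u) (indicator≤1 v)) (non-adjacent d p)
        where
          non-adjacent : ∀ d → Walk G u v d → 1 < d
          non-adjacent zero p = ⊥-elim (u≢v (walk-0⇒≡ p))
          non-adjacent 1 p = ⊥-elim (indep u v (member u 0<Su) (member v 0<Sv) (walk-1⇒edge p))
          non-adjacent (suc (suc _)) _ = s≤s (s≤s z≤n)

  α≡β-of-tight-independent-set :
    (∀ v → ∃ λ u → u ≢ v × G v u) → ∀ {k} S → IsIndependentSet G S → ∣ S ∣ ≡ k →
    (∀ f → IsIndependentBroadcast G f → cost f ≤ k) →
    IndepNumber G k × BroadcastIndepNumber G k
  α≡β-of-tight-independent-set neighbour S indep ∣S∣≡k cost≤k =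
    ((S , indep , ∣S∣≡k) , λ T indepT → subst (_≤ _) (cost-indicator T) (cost≤k _ (broadcast T indepT))) ,
    ((indicator S , broadcast S indep , trans (cost-indicator S) ∣S∣≡k) , cost≤k)
    where broadcast = indicator-independent neighbour

-- Pigeonhole for lists of distinct naturals

lookup-injective : ∀ {xs : List ℕ} → Unique xs → ∀ {i j} → List.lookup xs i ≡ List.lookup xs j → i ≡ j
lookup-injective (_ ∷ _) {Fin.zero} {Fin.zero} _ = refl
lookup-injective (x∉xs ∷ _) {Fin.zero} {Fin.suc j} x≡ = ⊥-elim (All.lookup x∉xs (∈-lookup j) x≡)
lookup-injective (x∉xs ∷ _) {Fin.suc i} {Fin.zero} ≡x = ⊥-elim (All.lookup x∉xs (∈-lookup i) (sym ≡x))
lookup-injective (_ ∷ unique) {Fin.suc i} {Fin.suc j} eq = cong Fin.suc (lookup-injective unique eq)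

module _ {xs : List ℕ} (unique : Unique xs) {m : ℕ} (bounded : ∀ {x} → x List.∈ xs → x < m) where

  private
    index : Fin (length xs) → Fin m
    index i = fromℕ< (bounded (∈-lookup i))

    index-injective : ∀ {i j} → index i ≡ index j → i ≡ j
    index-injective eq = lookup-injective unique (fromℕ<-injective _ _ _ _ eq)

  length-unique-bounded : length xs ≤ m
  length-unique-bounded = injective⇒≤ index-injective

  length-unique-bounded-missing : ∀ {r} → r < m → r List.∉ xs → length xs < m
  length-unique-bounded-missing {r} r<m r∉xs = injective⇒≤ extended-injective
    where
      extended : Fin (suc (length xs)) → Fin m
      extended Fin.zero = fromℕ< r<m
      extended (Fin.suc i) = index i
      r≢lookup : ∀ i → fromℕ< r<m ≢ index i
      r≢lookup i eq = r∉xs (subst (List._∈ xs) (sym (fromℕ<-injective _ _ _ _ eq)) (∈-lookup i))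
      extended-injective : ∀ {i j} → extended i ≡ extended j → i ≡ j
      extended-injective {Fin.zero} {Fin.zero} _ = refl
      extended-injective {Fin.zero} {Fin.suc j} eq = ⊥-elim (r≢lookup j eq)
      extended-injective {Fin.suc i} {Fin.zero} eq = ⊥-elim (r≢lookup i (sym eq))
      extended-injective {Fin.suc i} {Fin.suc j} eq = cong Fin.suc (index-injective eq)

-- Arithmetic

%-cancelʳ-+ : ∀ m .{{_ : NonZero m}} x y k → (x + k) % m ≡ (y + k) % m → x % m ≡ y % m
%-cancelʳ-+ m@(suc m′) x y k eq = begin
    x % m                                  ≡⟨ via x ⟩
    ((x + k) % m + (k * m′) % m) % m       ≡⟨ cong (λ r → (r + (k * m′) % m) % m) eq ⟩
    ((y + k) % m + (k * m′) % m) % m       ≡⟨ sym (via y) ⟩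
    y % m                                  ∎
  where
    open ≡-Reasoning
    via : ∀ z → z % m ≡ ((z + k) % m + (k * m′) % m) % m
    via z = begin
      z % m                              ≡⟨ sym ([m+kn]%n≡m%n z k m) ⟩
      (z + k * m) % m                    ≡⟨ cong (λ t → (z + t) % m) (*-suc k m′) ⟩
      (z + (k + k * m′)) % m             ≡⟨ cong (_% m) (sym (+-assoc z k (k * m′))) ⟩
      (z + k + k * m′) % m               ≡⟨ %-distribˡ-+ (z + k) (k * m′) m ⟩
      ((z + k) % m + (k * m′) % m) % m   ∎

%-cancelˡ-+ : ∀ m .{{_ : NonZero m}} k x y → (k + x) % m ≡ (k + y) % m → x % m ≡ y % m
%-cancelˡ-+ m k x y eq = %-cancelʳ-+ m x y k (trans (cong (_% m) (+-comm x k)) (trans eq (cong (_% m) (+-comm k y))))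

[m%n+o]%n≡[m+o]%n : ∀ m o n .{{_ : NonZero n}} → (m % n + o) % n ≡ (m + o) % n
[m%n+o]%n≡[m+o]%n m o n = begin
    (m % n + o) % n            ≡⟨ %-distribˡ-+ (m % n) o n ⟩
    (m % n % n + o % n) % n    ≡⟨ cong (λ r → (r + o % n) % n) (m%n%n≡m%n m n) ⟩
    (m % n + o % n) % n        ≡⟨ sym (%-distribˡ-+ m o n) ⟩
    (m + o) % n                ∎
  where open ≡-Reasoning

%-+ʳ : ∀ x y k n .{{_ : NonZero n}} → x % n ≡ y % n → (x + k) % n ≡ (y + k) % n
%-+ʳ x y k n eq = begin
    (x + k) % n        ≡⟨ sym ([m%n+o]%n≡[m+o]%n x k n) ⟩
    (x % n + k) % n    ≡⟨ cong (λ r → (r + k) % n) eq ⟩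
    (y % n + k) % n    ≡⟨ [m%n+o]%n≡[m+o]%n y k n ⟩
    (y + k) % n        ∎
  where open ≡-Reasoning

%-+-suc : ∀ x y i k n .{{_ : NonZero n}} → (x + i) % n ≡ (y + k) % n → (x + suc i) % n ≡ (y + suc k) % n
%-+-suc x y i k n eq = begin
    (x + suc i) % n    ≡⟨ cong (_% n) (trans (+-suc x i) (+-comm 1 (x + i))) ⟩
    (x + i + 1) % n    ≡⟨ %-+ʳ (x + i) (y + k) 1 n eq ⟩
    (y + k + 1) % n    ≡⟨ cong (_% n) (trans (+-comm (y + k) 1) (sym (+-suc y k))) ⟩
    (y + suc k) % n    ∎
  where open ≡-Reasoning

%-below-double : ∀ {z n} .{{_ : NonZero n}} → z < n + n → z % n ≡ z ⊎ z % n + n ≡ z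
%-below-double {z} {n} z<2n with z <? n
... | yes z<n = inj₁ (m<n⇒m%n≡m z<n)
... | no z≮n = inj₂ (begin
      z % n + n         ≡⟨ cong (_+ n) (sym (m≤n⇒[n∸m]%m≡n%m n≤z)) ⟩
      (z ∸ n) % n + n   ≡⟨ cong (_+ n) (m<n⇒m%n≡m (m<n+o⇒m∸n<o z n z<2n)) ⟩
      z ∸ n + n         ≡⟨ m∸n+n≡m n≤z ⟩
      z                 ∎)
  where
    open ≡-Reasoning
    n≤z = ≮⇒≥ z≮n

0ℙ≢1ℙ : 0ℙ ≢ 1ℙ
0ℙ≢1ℙ ()

≢0ℙ⇒≡1ℙ : ∀ {p} → p ≢ 0ℙ → p ≡ 1ℙ
≢0ℙ⇒≡1ℙ {0ℙ} p≢0ℙ = ⊥-elim (p≢0ℙ refl)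
≢0ℙ⇒≡1ℙ {1ℙ} _ = refl

even⇒2∣ : ∀ n → parity n ≡ 0ℙ → 2 ∣ n
even⇒2∣ zero _ = 2 ∣0
even⇒2∣ (suc (suc n)) n-even = ∣m∣n⇒∣m+n n∣n (even⇒2∣ n n-even)

halve : ∀ n → ∃ λ k → n ≡ 2 * k ⊎ n ≡ suc (2 * k)
halve zero = 0 , inj₁ refl
halve (suc n) with halve n
... | k , inj₁ n≡2k = k , inj₂ (cong suc n≡2k)
... | k , inj₂ n≡1+2k = suc k , inj₁ (cong suc (trans n≡1+2k (sym (+-suc k (k + 0)))))

odd-part : ∀ n → 0 < n → ∃ λ t → ∃ λ r → n ≡ 2 ^ t * suc (2 * r)
odd-part = <-rec _ λ n smaller 0<n → split n smaller 0<n (halve n)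
  where
    split : ∀ n → (∀ {k} → k < n → 0 < k → ∃ λ t → ∃ λ r → k ≡ 2 ^ t * suc (2 * r)) → 0 < n →
            (∃ λ k → n ≡ 2 * k ⊎ n ≡ suc (2 * k)) → ∃ λ t → ∃ λ r → n ≡ 2 ^ t * suc (2 * r)
    split n _ _ (k , inj₂ n≡1+2k) = 0 , k , trans n≡1+2k (sym (+-identityʳ _))
    split n smaller 0<n (zero , inj₁ refl) = ⊥-elim (n≮0 0<n)
    split n smaller 0<n (k@(suc _) , inj₁ n≡2k) with smaller k<n (s≤s z≤n)
      where
        k<n : k < n
        k<n = subst (k <_) (sym n≡2k) (m<m+n k (≤-trans (s≤s z≤n) (m≤m+n k 0)))
    ... | t , r , k≡ = suc t , r , trans n≡2k (trans (cong (2 *_) k≡) (sym (*-assoc 2 (2 ^ t) _)))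

odd-factor : ∀ a → 2 ≤ a → ¬ (∃ λ p → 1 ≤ p × a ≡ 2 ^ p) →
             ∃ λ m → ∃ λ H → ∃ λ r → a ≡ m * H × m ≡ suc (2 * r) × 1 ≤ r × 0 < H
odd-factor a 2≤a not-power with odd-part a (≤-trans (s≤s z≤n) 2≤a)
... | zero , zero , refl = ⊥-elim (<-irrefl refl 2≤a)
... | suc t , zero , a≡ = ⊥-elim (not-power (suc t , s≤s z≤n , trans a≡ (*-identityʳ _)))
... | t , suc r , a≡ =
  suc (2 * suc r) , 2 ^ t , suc r , trans a≡ (*-comm (2 ^ t) _) , refl , s≤s z≤n , m^n>0 2 t

module _ (p H : ℕ) (closing : ∀ k → 2 ^ p ∣ k * H → 2 * 2 ^ p ∣ k * (H + 2 ^ p)) where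

  -- If 2^s ∣ H, then k = 2^(p − s) has 2^p ∣ kH, so 2^(p+1) ∣ k(H + 2^p), i.e. 2^(s+1) ∣ H + 2^p.
  2^s∣H : ∀ s → s ≤ p → 2 ^ s ∣ H
  2^s∣H zero _ = 1∣ H
  2^s∣H (suc s) s<p = ∣m+n∣m⇒∣n (subst (2 ^ suc s ∣_) (+-comm H (2 ^ p)) 2^[1+s]∣H+2^p) 2^[1+s]∣2^p
    where
      e = p ∸ suc s
      1+s+e≡p : suc s + e ≡ p
      1+s+e≡p = m+[n∸m]≡n s<p
      1+e+s≡p : suc e + s ≡ p
      1+e+s≡p = trans (cong suc (+-comm e s)) 1+s+e≡p
      2^[1+s]∣2^p : 2 ^ suc s ∣ 2 ^ p
      2^[1+s]∣2^p = subst (2 ^ suc s ∣_) (trans (sym (^-distribˡ-+-* 2 (suc s) e)) (cong (2 ^_) 1+s+e≡p))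
                      (m∣m*n (2 ^ e))
      2^p∣2^[1+e]*H : 2 ^ p ∣ 2 ^ suc e * H
      2^p∣2^[1+e]*H = subst (_∣ 2 ^ suc e * H) (trans (sym (^-distribˡ-+-* 2 (suc e) s)) (cong (2 ^_) 1+e+s≡p))
                        (*-monoʳ-∣ (2 ^ suc e) (2^s∣H s (≤-trans (n≤1+n s) s<p)))
      2^[1+p]≡ : 2 * 2 ^ p ≡ 2 ^ suc e * 2 ^ suc s
      2^[1+p]≡ = trans (cong (λ t → 2 ^ suc t) (sym (trans (+-suc e s) 1+e+s≡p)))
                       (^-distribˡ-+-* 2 (suc e) (suc s))
      2^[1+s]∣H+2^p : 2 ^ suc s ∣ H + 2 ^ p
      2^[1+s]∣H+2^p = *-cancelˡ-∣ (2 ^ suc e) {{m^n≢0 2 (suc e)}}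
                        (subst (_∣ 2 ^ suc e * (H + 2 ^ p)) 2^[1+p]≡ (closing (2 ^ suc e) 2^p∣2^[1+e]*H))

multiple-within-one : ∀ {H n c} → 0 < H → H * n + c ≤ H → n ≡ 0 ⊎ n ≡ 1 × c ≡ 0
multiple-within-one {H} {zero} _ _ = inj₁ refl
multiple-within-one {H} {1} {c} _ H*1+c≤H =
  inj₂ (refl , n≤0⇒n≡0 (+-cancelˡ-≤ H c 0 (subst₂ (λ x y → x + c ≤ y) (*-identityʳ H) (sym (+-identityʳ H)) H*1+c≤H)))
multiple-within-one {H} {suc (suc n)} {c} 0<H H*n+c≤H =
  ⊥-elim (<⇒≱ (m<m*n H (suc (suc n)) {{>-nonZero 0<H}} (s≤s (s≤s z≤n))) (≤-trans (m≤m+n _ c) H*n+c≤H))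

module OddMultipleRigidity where
  open import Data.Integer using (ℤ; +_; -_) renaming (_+_ to _+ℤ_; _-_ to _-ℤ_; _*_ to _*ℤ_; ∣_∣ to ∣_∣ℤ)
  open import Data.Integer.Properties using (pos-+; pos-*; abs-*; ∣i∣≡0⇒i≡0; m-n≡m⊖n; ∣m⊝n∣≤m⊔n)
    renaming (*-cancelˡ-≡ to *ℤ-cancelˡ-≡; *-zeroʳ to *ℤ-zeroʳ; +-identityˡ to +ℤ-identityˡ)
  open import Data.Integer.Tactic.RingSolver using (solve-∀)

  ∣m-n∣<o : ∀ {m n o} → m < o → n < o → ∣ + m -ℤ + n ∣ℤ < o
  ∣m-n∣<o {m} {n} m<o n<o =
    subst (_< _) (sym (cong ∣_∣ℤ (m-n≡m⊖n m n))) (≤-<-trans (∣m⊝n∣≤m⊔n m n) (⊔-lub m<o n<o))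

  odd-splits : ∀ r → + suc (2 * r) ≡ + 1 +ℤ + 2 *ℤ + r
  odd-splits r = trans (pos-+ 1 (2 * r)) (cong (λ t → + 1 +ℤ t) (pos-* 2 r))

  small-multiple≡0 : ∀ m w → ∣ + m *ℤ w ∣ℤ < m → + m *ℤ w ≡ + 0
  small-multiple≡0 m w small = by-size ∣ w ∣ℤ refl
    where
      by-size : ∀ n → ∣ w ∣ℤ ≡ n → + m *ℤ w ≡ + 0
      by-size zero ∣w∣≡0 = trans (cong (+ m *ℤ_) (∣i∣≡0⇒i≡0 ∣w∣≡0)) (*ℤ-zeroʳ (+ m))
      by-size (suc n) ∣w∣≡ =
        ⊥-elim (<⇒≱ small (≤-trans (m≤m*n m (suc n)) (≤-reflexive (sym (trans (abs-* (+ m) w) (cong (m *_) ∣w∣≡))))))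

  double≡odd*⇒0 : ∀ {m} r (d u : ℤ) → m ≡ suc (2 * r) → + 2 *ℤ d ≡ + m *ℤ u → ∣ d ∣ℤ < m → d ≡ + 0
  double≡odd*⇒0 {m} r d u refl 2d≡mu ∣d∣<m =
    trans d≡mw (small-multiple≡0 m w (subst (λ t → ∣ t ∣ℤ < m) d≡mw ∣d∣<m))
    where
      w = d -ℤ + r *ℤ u
      u≡2w : u ≡ + 2 *ℤ w
      u≡2w = begin
        u                                              ≡⟨ odd-cancels (+ r) u ⟩
        (+ 1 +ℤ + 2 *ℤ + r) *ℤ u -ℤ + 2 *ℤ + r *ℤ u    ≡⟨ cong (λ t → t *ℤ u -ℤ + 2 *ℤ + r *ℤ u) (sym (odd-splits r)) ⟩
        + m *ℤ u -ℤ + 2 *ℤ + r *ℤ u                    ≡⟨ cong (λ t → t -ℤ + 2 *ℤ + r *ℤ u) (sym 2d≡mu) ⟩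
        + 2 *ℤ d -ℤ + 2 *ℤ + r *ℤ u                    ≡⟨ factor-2 d (+ r) u ⟩
        + 2 *ℤ w                                       ∎
        where
          open ≡-Reasoning
          odd-cancels : ∀ r u → u ≡ (+ 1 +ℤ + 2 *ℤ r) *ℤ u -ℤ + 2 *ℤ r *ℤ u
          odd-cancels = solve-∀
          factor-2 : ∀ d r u → + 2 *ℤ d -ℤ + 2 *ℤ r *ℤ u ≡ + 2 *ℤ (d -ℤ r *ℤ u)
          factor-2 = solve-∀
      d≡mw : d ≡ + m *ℤ w
      d≡mw = *ℤ-cancelˡ-≡ (+ 2) d (+ m *ℤ w) (trans 2d≡mu (trans (cong (+ m *ℤ_) u≡2w) (swap (+ m) w)))
        where
          swap : ∀ m w → m *ℤ (+ 2 *ℤ w) ≡ + 2 *ℤ (m *ℤ w)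
          swap = solve-∀

  ∣2*i∣≢1 : ∀ i → ∣ + 2 *ℤ i ∣ℤ ≢ 1
  ∣2*i∣≢1 i ∣2i∣≡1 with m*n≡1⇒m≡1 2 ∣ i ∣ℤ (trans (sym (abs-* (+ 2) i)) ∣2i∣≡1)
  ... | ()

  unit-steps-divisible : ∀ {m H c} (s d k : ℤ) →
    + 2 *ℤ + H *ℤ d ≡ s +ℤ + c *ℤ (+ m *ℤ + H) +ℤ k *ℤ (+ 2 *ℤ (+ m *ℤ + H)) →
    s ≡ + H *ℤ (+ 2 *ℤ d -ℤ + c *ℤ + m -ℤ + 2 *ℤ k *ℤ + m)
  unit-steps-divisible {m} {H} {c} s d k eq = begin
    s                                     ≡⟨ cancel s C K ⟩
    s +ℤ C +ℤ K -ℤ C -ℤ K                 ≡⟨ cong (λ z → z -ℤ C -ℤ K) (sym eq) ⟩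
    + 2 *ℤ + H *ℤ d -ℤ C -ℤ K             ≡⟨ factor (+ H) (+ m) d (+ c) k ⟩
    + H *ℤ (+ 2 *ℤ d -ℤ + c *ℤ + m -ℤ + 2 *ℤ k *ℤ + m)   ∎
    where
      open ≡-Reasoning
      C = + c *ℤ (+ m *ℤ + H)
      K = k *ℤ (+ 2 *ℤ (+ m *ℤ + H))
      cancel : ∀ s C K → s ≡ s +ℤ C +ℤ K -ℤ C -ℤ K
      cancel = solve-∀
      factor : ∀ h m d c k → + 2 *ℤ h *ℤ d -ℤ c *ℤ (m *ℤ h) -ℤ k *ℤ (+ 2 *ℤ (m *ℤ h))
                             ≡ h *ℤ (+ 2 *ℤ d -ℤ c *ℤ m -ℤ + 2 *ℤ k *ℤ m)
      factor = solve-∀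

  -- s = H·t with H∣t∣ + c ≤ H.  If ∣t∣ = 1 then c = 0 and t is even; so t = 0, 2d = m(c + 2k), and as m is
  -- odd d is a multiple of m.
  displacement-rigid : ∀ {m H c} r (s d k : ℤ) → m ≡ suc (2 * r) → 0 < H → ∣ d ∣ℤ < m → ∣ s ∣ℤ + c ≤ H →
    + 2 *ℤ + H *ℤ d ≡ s +ℤ + c *ℤ (+ m *ℤ + H) +ℤ k *ℤ (+ 2 *ℤ (+ m *ℤ + H)) → d ≡ + 0
  displacement-rigid {m} {H} {c} r s d k m≡ 0<H ∣d∣<m bound eq = by-cases (multiple-within-one 0<H H∣t∣+c≤H)
    where
      open ≡-Reasoning
      t : ℤ
      t = + 2 *ℤ d -ℤ + c *ℤ + m -ℤ + 2 *ℤ k *ℤ + m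
      H∣t∣+c≤H : H * ∣ t ∣ℤ + c ≤ H
      H∣t∣+c≤H = subst (λ z → z + c ≤ H) (trans (cong ∣_∣ℤ (unit-steps-divisible {m} {H} {c} s d k eq)) (abs-* (+ H) t))
                   bound
      by-cases : ∣ t ∣ℤ ≡ 0 ⊎ ∣ t ∣ℤ ≡ 1 × c ≡ 0 → d ≡ + 0
      by-cases (inj₁ ∣t∣≡0) = double≡odd*⇒0 r d (+ c +ℤ + 2 *ℤ k) m≡ (begin
        + 2 *ℤ d                             ≡⟨ expand d (+ c) (+ m) k ⟩
        t +ℤ + m *ℤ (+ c +ℤ + 2 *ℤ k)        ≡⟨ cong (_+ℤ + m *ℤ (+ c +ℤ + 2 *ℤ k)) (∣i∣≡0⇒i≡0 {t} ∣t∣≡0) ⟩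
        + 0 +ℤ + m *ℤ (+ c +ℤ + 2 *ℤ k)      ≡⟨ +ℤ-identityˡ _ ⟩
        + m *ℤ (+ c +ℤ + 2 *ℤ k)             ∎) ∣d∣<m
        where
          expand : ∀ d c m k → + 2 *ℤ d ≡ (+ 2 *ℤ d -ℤ c *ℤ m -ℤ + 2 *ℤ k *ℤ m) +ℤ m *ℤ (c +ℤ + 2 *ℤ k)
          expand = solve-∀
      by-cases (inj₂ (∣t∣≡1 , c≡0)) = ⊥-elim (∣2*i∣≢1 (d -ℤ k *ℤ + m) (trans (cong ∣_∣ℤ (sym t-even)) ∣t∣≡1))
        where
          factor-2 : ∀ d k m → + 2 *ℤ d -ℤ + 0 *ℤ m -ℤ + 2 *ℤ k *ℤ m ≡ + 2 *ℤ (d -ℤ k *ℤ m)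
          factor-2 = solve-∀
          t-even : t ≡ + 2 *ℤ (d -ℤ k *ℤ + m)
          t-even = trans (cong (λ c′ → + 2 *ℤ d -ℤ + c′ *ℤ + m -ℤ + 2 *ℤ k *ℤ + m) c≡0) (factor-2 d k (+ m))

-- The circulant C(2a; 1, a)

-- a = b + 1 keeps NonZero a and NonZero N available by computation.
module Circulant (b : ℕ) where

  a : ℕ
  a = suc b

  N : ℕ
  N = 2 * a

  G : Rel N
  G = Circ N a

  open Walks G

  1<N : 1 < N
  1<N = s≤s (≤-trans (s≤s z≤n) (m≤n+m (1 * a) b))

  N≡a+a : N ≡ a + a
  N≡a+a = cong (a +_) (+-identityʳ a)

  a<N : a < N
  a<N = subst (a <_) (sym N≡a+a) (m<m+n a (s≤s z≤n))

  %N%a : ∀ x → x % N % a ≡ x % a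
  %N%a x = m∣n⇒o%n%m≡o%m a N x (divides 2 refl)

  vertex : ℕ → Fin N
  vertex x = x mod N

  toℕ-vertex : ∀ x → toℕ (vertex x) ≡ x % N
  toℕ-vertex x = toℕ-fromℕ< (m%n<n x N)

  vertex-toℕ : ∀ u → vertex (toℕ u) ≡ u
  vertex-toℕ u = toℕ-injective (trans (toℕ-vertex (toℕ u)) (m<n⇒m%n≡m (toℕ<n u)))

  vertex-cong : ∀ x y → x % N ≡ y % N → vertex x ≡ vertex y
  vertex-cong x y eq = toℕ-injective (trans (toℕ-vertex x) (trans eq (sym (toℕ-vertex y))))

  vertex-+ : ∀ x y → vertex (toℕ (vertex x) + y) ≡ vertex (x + y)
  vertex-+ x y = vertex-cong (toℕ (vertex x) + y) (x + y)
    (trans (cong (λ t → (t + y) % N) (toℕ-vertex x)) ([m%n+o]%n≡[m+o]%n x y N))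

  vertex-+N : ∀ x → vertex (x + N) ≡ vertex x
  vertex-+N x = vertex-cong (x + N) x ([m+n]%n≡m%n x N)

  shift-vertex : ∀ u s → s ≤ N → Shift N s u (vertex (toℕ u + s))
  shift-vertex u s s≤N with %-below-double (+-mono-<-≤ (toℕ<n u) s≤N)
  ... | inj₁ eq = inj₁ (trans (toℕ-vertex (toℕ u + s)) eq)
  ... | inj₂ eq = inj₂ (trans (cong (_+ N) (toℕ-vertex (toℕ u + s))) eq)

  edge-1 : ∀ u → G u (vertex (toℕ u + 1))
  edge-1 u = inj₁ (shift-vertex u 1 (s≤s z≤n))

  edge-a : ∀ u → G u (vertex (toℕ u + a))
  edge-a u = inj₂ (inj₂ (inj₁ (shift-vertex u a (m≤m+n a (a + 0)))))

  edge-sym : ∀ {u v} → G u v → G v u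
  edge-sym (inj₁ s) = inj₂ (inj₁ s)
  edge-sym (inj₂ (inj₁ s)) = inj₁ s
  edge-sym (inj₂ (inj₂ (inj₁ s))) = inj₂ (inj₂ (inj₂ s))
  edge-sym (inj₂ (inj₂ (inj₂ s))) = inj₂ (inj₂ (inj₁ s))

  reverse : ∀ {u v L} → Walk G u v L → Walk G v u L
  reverse here = here
  reverse (step e p) = subst (Walk G _ _) (+-comm _ 1) (reverse p ++ʷ step (edge-sym e) here)

  forward : ∀ u j → Walk G u (vertex (toℕ u + j)) j
  forward u zero = subst (λ w → Walk G u w 0) (sym (trans (cong vertex (+-identityʳ (toℕ u))) (vertex-toℕ u)))
                         here
  forward u (suc j) = step (edge-1 u) (subst (λ w → Walk G _ w j) arrive (forward (vertex (toℕ u + 1)) j))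
    where
      arrive : vertex (toℕ (vertex (toℕ u + 1)) + j) ≡ vertex (toℕ u + suc j)
      arrive = trans (vertex-+ (toℕ u + 1) j) (cong vertex (+-assoc (toℕ u) 1 j))

  forward-across : ∀ u j → Walk G u (vertex (toℕ u + j + a)) (suc j)
  forward-across u j = subst (Walk G _ _) (+-comm j 1)
    (forward u j ++ʷ step (subst (G _) (vertex-+ (toℕ u + j) a) (edge-a (vertex (toℕ u + j)))) here)

  neighbour : ∀ v → ∃ λ u → u ≢ v × G v u
  neighbour v = vertex (toℕ v + 1) , v+1≢v , edge-1 v
    where
      v+1≢v : vertex (toℕ v + 1) ≢ v
      v+1≢v eq with %-below-double {n = N} (+-mono-<-≤ (toℕ<n v) (s≤s z≤n))
      ... | inj₁ no-wrap = 1+n≢n (trans (+-comm 1 (toℕ v)) (trans (sym no-wrap) (trans (sym v+1%N) (cong toℕ eq))))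
        where v+1%N = toℕ-vertex (toℕ v + 1)
      ... | inj₂ wrap =
        <-irrefl (+-cancelˡ-≡ (toℕ v) 1 N (sym (trans (cong (_+ N) (trans (cong toℕ (sym eq)) v+1%N)) wrap))) 1<N
        where v+1%N = toℕ-vertex (toℕ v + 1)

  below-N : ∀ {z} → z < N → z < a ⊎ ∃ λ z′ → z′ < a × z ≡ z′ + a
  below-N {z} z<N with z <? a
  ... | yes z<a = inj₁ z<a
  ... | no z≮a = inj₂ (z ∸ a , m<n+o⇒m∸n<o z a (subst (z <_) N≡a+a z<N) , sym (m∸n+n≡m (≮⇒≥ z≮a)))

  residue-injective : ∀ {x y} → x < a → y < a → x % a ≡ y % a → x ≡ y
  residue-injective x<a y<a eq = trans (sym (m<n⇒m%n≡m x<a)) (trans eq (m<n⇒m%n≡m y<a))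

  same-residue : ∀ {z w} → z < N → w < N → z % a ≡ w % a → w ≡ z ⊎ w ≡ (z + a) % N
  same-residue {z} {w} z<N w<N eq with below-N z<N | below-N w<N
  ... | inj₁ z<a | inj₁ w<a = inj₁ (residue-injective w<a z<a (sym eq))
  ... | inj₁ z<a | inj₂ (w′ , w′<a , refl) =
    inj₂ (trans (cong (_+ a) w′≡z) (sym (m<n⇒m%n≡m (subst (λ t → t + a < N) w′≡z w<N))))
    where
      w′≡z : w′ ≡ z
      w′≡z = residue-injective w′<a z<a (trans (sym ([m+n]%n≡m%n w′ a)) (sym eq))
  ... | inj₂ (z′ , z′<a , refl) | inj₁ w<a = inj₂ (sym (begin
      (z′ + a + a) % N    ≡⟨ cong (_% N) (trans (+-assoc z′ a a) (cong (z′ +_) (sym N≡a+a))) ⟩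
      (z′ + N) % N        ≡⟨ [m+n]%n≡m%n z′ N ⟩
      z′ % N              ≡⟨ m<n⇒m%n≡m (<-trans z′<a (m<m+n a (m≤m+n 1 (b + 0)))) ⟩
      z′                  ≡⟨ residue-injective z′<a w<a (trans (sym ([m+n]%n≡m%n z′ a)) eq) ⟩
      w                   ∎))
    where open ≡-Reasoning
  ... | inj₂ (z′ , z′<a , refl) | inj₂ (w′ , w′<a , refl) =
    inj₁ (cong (_+ a) (residue-injective w′<a z′<a
      (trans (sym ([m+n]%n≡m%n w′ a)) (trans (sym eq) ([m+n]%n≡m%n z′ a)))))

  residue-position : ∀ (v w : Fin N) j → (toℕ v + j) % a ≡ toℕ w % a →
                     w ≡ vertex (toℕ v + j) ⊎ w ≡ vertex (toℕ v + j + a)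
  residue-position v w j eq
    with same-residue (toℕ<n (vertex (toℕ v + j))) (toℕ<n w)
           (trans (cong (_% a) (toℕ-vertex (toℕ v + j))) (trans (%N%a (toℕ v + j)) eq))
  ... | inj₁ w≡ = inj₁ (toℕ-injective w≡)
  ... | inj₂ w≡ = inj₂ (toℕ-injective (begin
      toℕ w                        ≡⟨ w≡ ⟩
      (toℕ (vertex x) + a) % N     ≡⟨ cong (λ t → (t + a) % N) (toℕ-vertex x) ⟩
      (x % N + a) % N              ≡⟨ [m%n+o]%n≡[m+o]%n x a N ⟩
      (x + a) % N                  ≡⟨ sym (toℕ-vertex (x + a)) ⟩
      toℕ (vertex (x + a))         ∎))
    where
      open ≡-Reasoning
      x = toℕ v + j

  walk-to-residue : ∀ (v w : Fin N) j → (toℕ v + j) % a ≡ toℕ w % a →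
                    ∃ λ L → L ≤ suc j × Walk G v w L
  walk-to-residue v w j eq = [ direct , across ]′ (residue-position v w j eq)
    where
      direct : w ≡ vertex (toℕ v + j) → ∃ λ L → L ≤ suc j × Walk G v w L
      direct w≡ = j , n≤1+n j , subst (λ t → Walk G v t j) (sym w≡) (forward v j)
      across : w ≡ vertex (toℕ v + j + a) → ∃ λ L → L ≤ suc j × Walk G v w L
      across w≡ = suc j , ≤-refl , subst (λ t → Walk G v t (suc j)) (sym w≡) (forward-across v j)

  offset : ∀ v u → ∃ λ t → t < N × vertex (toℕ v + t) ≡ u
  offset v u = t , m%n<n x N , trans (vertex-cong (toℕ v + t) (toℕ u) (begin
      (toℕ v + x % N) % N    ≡⟨ cong (_% N) (+-comm (toℕ v) (x % N)) ⟩
      (x % N + toℕ v) % N    ≡⟨ [m%n+o]%n≡[m+o]%n x (toℕ v) N ⟩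
      (x + toℕ v) % N        ≡⟨ cong (_% N) (trans (+-assoc (toℕ u) _ (toℕ v))
                                                   (cong (toℕ u +_) (m∸n+n≡m (<⇒≤ (toℕ<n v))))) ⟩
      (toℕ u + N) % N        ≡⟨ [m+n]%n≡m%n (toℕ u) N ⟩
      toℕ u % N              ∎)) (vertex-toℕ u)
    where
      open ≡-Reasoning
      x = toℕ u + (N ∸ toℕ v)
      t = x % N

  radius : 1 ≤ b → ∀ v u → ∃ λ L → L ≤ b × Walk G v u L
  radius 1≤b v u with offset v u
  ... | t , t<N , arrive with <-cmp t a
  ... | tri< t<a _ _ = t , ≤-pred t<a , subst (λ w → Walk G v w t) arrive (forward v t)
  ... | tri≈ _ refl _ = 1 , 1≤b , step (subst (G v) arrive (edge-a v)) here
  ... | tri> _ _ a<t = N ∸ t , back≤b , reverse (subst (λ w → Walk G u w (N ∸ t)) back (forward u (N ∸ t)))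
    where
      back : vertex (toℕ u + (N ∸ t)) ≡ v
      back = begin
        vertex (toℕ u + (N ∸ t))                        ≡⟨ cong (λ w → vertex (toℕ w + (N ∸ t))) (sym arrive) ⟩
        vertex (toℕ (vertex (toℕ v + t)) + (N ∸ t))     ≡⟨ vertex-+ (toℕ v + t) (N ∸ t) ⟩
        vertex (toℕ v + t + (N ∸ t))                    ≡⟨ cong vertex (trans (+-assoc (toℕ v) t _)
                                                                             (cong (toℕ v +_) (m+[n∸m]≡n (<⇒≤ t<N)))) ⟩
        vertex (toℕ v + N)                              ≡⟨ vertex-+N (toℕ v) ⟩
        vertex (toℕ v)                                  ≡⟨ vertex-toℕ v ⟩
        v                                               ∎
        where open ≡-Reasoning
      back≤b : N ∸ t ≤ b
      back≤b = ≤-trans (∸-monoʳ-≤ N a<t)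
                       (≤-reflexive (trans (cong (λ c → b + suc c ∸ suc b) (+-identityʳ b)) (m+n∸n≡m b (suc b))))

  shift? : ∀ s u v → Dec (Shift N s u v)
  shift? s u v = (toℕ v ≟ toℕ u + s) ⊎-dec (toℕ v + N ≟ toℕ u + s)

  edge? : ∀ u v → Dec (G u v)
  edge? u v = shift? 1 u v ⊎-dec shift? 1 v u ⊎-dec shift? a u v ⊎-dec shift? a v u

  module Broadcast (1≤b : 1 ≤ b) {f : Fin N → ℕ} (ib : IsIndependentBroadcast G f) where
    open IndependentBroadcastProperties edge? ib

    f<a : ∀ v → f v < a
    f<a v = s≤s (≤-radius v b (radius 1≤b v))

    residue-gap : ∀ {v w} j → v ≢ w → 0 < f v → 0 < f w → (toℕ v + j) % a ≡ toℕ w % a →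
                  f v ≤ j × f w ≤ j
    residue-gap j v≢w 0<fv 0<fw eq with walk-to-residue _ _ j eq
    ... | L , L≤1+j , p = ≤-pred (≤-trans (<-walk-length v≢w 0<fv 0<fw p) L≤1+j) ,
                          ≤-pred (≤-trans (<-walk-length (v≢w ∘ sym) 0<fw 0<fv (reverse p)) L≤1+j)

    offset-gap : ∀ {v w i i′} → i′ ≤ i → v ≢ w → 0 < f v → 0 < f w →
                 (toℕ v + i) % a ≡ (toℕ w + i′) % a → f v ≤ i ∸ i′
    offset-gap {v} {w} {i} {i′} i′≤i v≢w 0<fv 0<fw eq =
      proj₁ (residue-gap (i ∸ i′) v≢w 0<fv 0<fw (%-cancelʳ-+ a (toℕ v + (i ∸ i′)) (toℕ w) i′ (begin
        (toℕ v + (i ∸ i′) + i′) % a   ≡⟨ cong (_% a) (trans (+-assoc (toℕ v) _ i′)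
                                                            (cong (toℕ v +_) (m∸n+n≡m i′≤i))) ⟩
        (toℕ v + i) % a               ≡⟨ eq ⟩
        (toℕ w + i′) % a              ∎)))
      where open ≡-Reasoning

    offsets-gap : ∀ {v w} i i′ → v ≢ w → 0 < f v → 0 < f w → (toℕ v + i) % a ≡ (toℕ w + i′) % a →
                  i′ ≤ i × f v ≤ i ∸ i′ ⊎ i ≤ i′ × f w ≤ i′ ∸ i
    offsets-gap i i′ v≢w 0<fv 0<fw eq with i′ ≤? i
    ... | yes i′≤i = inj₁ (i′≤i , offset-gap i′≤i v≢w 0<fv 0<fw eq)
    ... | no i′≰i = inj₂ (i≤i′ , offset-gap i≤i′ (v≢w ∘ sym) 0<fw 0<fv (sym eq))
      where i≤i′ = <⇒≤ (≰⇒> i′≰i)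

    arcs-disjoint : ∀ {v w i i′} → v ≢ w → i < f v → i′ < f w → (toℕ v + i) % a ≢ (toℕ w + i′) % a
    arcs-disjoint {i = i} {i′} v≢w i<fv i′<fw eq
      with offsets-gap i i′ v≢w (≤-<-trans z≤n i<fv) (≤-<-trans z≤n i′<fw) eq
    ... | inj₁ (_ , fv≤) = <-irrefl refl (<-≤-trans i<fv (≤-trans fv≤ (m∸n≤m i i′)))
    ... | inj₂ (_ , fw≤) = <-irrefl refl (<-≤-trans i′<fw (≤-trans fw≤ (m∸n≤m i′ i)))

    arc : Fin N → List ℕ
    arc v = List.applyUpTo (λ i → (toℕ v + i) % a) (f v)

    residues : List ℕ
    residues = List.concatMap arc (allFin N)

    length-residues : length residues ≡ cost f
    length-residues = go (allFin N)
      where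
        go : ∀ vs → length (List.concatMap arc vs) ≡ sum (map f vs)
        go List.[] = refl
        go (v List.∷ vs) = trans (length-++ (arc v)) (cong₂ _+_ (length-applyUpTo _ (f v)) (go vs))

    arc-unique : ∀ v → Unique (arc v)
    arc-unique v = Unique.applyUpTo⁺₁ _ (f v) λ {i} {j} i<j j<fv eq →
      <⇒≢ i<j (residue-injective (<-trans i<j (j<a j<fv)) (j<a j<fv) (%-cancelˡ-+ a (toℕ v) i j eq))
      where
        j<a : ∀ {j} → j < f v → j < a
        j<a j<fv = <-trans j<fv (f<a v)

    residues-unique : Unique residues
    residues-unique =
      Unique.concat⁺ (All-arcs (allFin N)) (AllPairs.map⁺ (AllPairs.map disjoint (Unique.allFin⁺ N)))
      where
        All-arcs : ∀ vs → All Unique (map arc vs)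
        All-arcs List.[] = All.[]
        All-arcs (v List.∷ vs) = arc-unique v All.∷ All-arcs vs
        disjoint : ∀ {v w} → v ≢ w → Disjoint (arc v) (arc w)
        disjoint v≢w (x∈v , x∈w) with ∈-applyUpTo⁻ _ x∈v | ∈-applyUpTo⁻ _ x∈w
        ... | i , i<fv , refl | i′ , i′<fw , eq = arcs-disjoint v≢w i<fv i′<fw eq

    residue-in-arc : ∀ {r} → r List.∈ residues → ∃ λ v → ∃ λ i → i < f v × r ≡ (toℕ v + i) % a
    residue-in-arc r∈ with ∈-concat⁻′ (map arc (allFin N)) r∈
    ... | xs , r∈xs , xs∈ with ∈-map⁻ arc xs∈
    ...   | v , _ , refl with ∈-applyUpTo⁻ _ r∈xs
    ...     | i , i<fv , r≡ = v , i , i<fv , r≡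

    residues-bounded : ∀ {r} → r List.∈ residues → r < a
    residues-bounded r∈ with residue-in-arc r∈
    ... | v , i , _ , refl = m%n<n (toℕ v + i) a

    cost≤a : cost f ≤ a
    cost≤a = subst (_≤ a) length-residues (length-unique-bounded residues-unique residues-bounded)

    record Owns (v : Fin N) (r : ℕ) : Set where
      constructor owns
      field
        {index} : ℕ
        index<f : index < f v
        residue : (toℕ v + index) % a ≡ r % a

    owns-broadcasting : ∀ {v r} → Owns v r → 0 < f v
    owns-broadcasting (owns i<fv _) = ≤-<-trans z≤n i<fv

    owns-unique : ∀ {v w r} → Owns v r → Owns w r → v ≡ w
    owns-unique {v} {w} (owns i<fv eq) (owns i′<fw eq′) with v Fin.≟ w
    ... | yes v≡w = v≡w
    ... | no v≢w = ⊥-elim (arcs-disjoint v≢w i<fv i′<fw (trans eq (sym eq′)))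

    owns-resp : ∀ {v r r′} → r % a ≡ r′ % a → Owns v r → Owns v r′
    owns-resp r≡r′ (owns i<fv eq) = owns i<fv (trans eq r≡r′)

    module Tight (tight : cost f ≡ a) where

      covered : ∀ r → ∃ λ v → Owns v r
      covered r with r % a ∈? residues
      ... | yes r∈ with residue-in-arc r∈
      ...   | v , i , i<fv , r≡ = v , owns i<fv (sym r≡)
      covered r | no r∉ = ⊥-elim (<-irrefl tight (subst (_< a) length-residues
                            (length-unique-bounded-missing residues-unique residues-bounded (m%n<n r a) r∉)))

      successor : ∀ {v w} → 0 < f v → Owns w (toℕ v + f v) → f w ≤ f v × w ≡ vertex (toℕ v + f v + a)
      successor {v} {w} 0<fv (owns {index = i′} i′<fw eq) = fw≤fv , position (residue-position v w (f v) residue)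
        where
          0<fw : 0 < f w
          0<fw = ≤-<-trans z≤n i′<fw
          w≢v : w ≢ v
          w≢v refl = <-irrefl (residue-injective (<-trans i′<fw (f<a v)) (f<a v) (%-cancelˡ-+ a (toℕ v) i′ (f v) eq)) i′<fw
          starts-arc : ∀ i′ → i′ < f w → (toℕ v + f v) % a ≡ (toℕ w + i′) % a → i′ ≡ 0
          starts-arc zero _ _ = refl
          starts-arc (suc k) 1+k<fw eq′ with offsets-gap (f v) (suc k) (w≢v ∘ sym) 0<fv 0<fw eq′
          ... | inj₁ (1+k≤fv , fv≤) = ⊥-elim (<-irrefl refl (≤-<-trans fv≤ (∸-monoʳ-< (s≤s z≤n) 1+k≤fv)))
          ... | inj₂ (_ , fw≤) = ⊥-elim (<-irrefl refl (<-≤-trans 1+k<fw (≤-trans fw≤ (m∸n≤m (suc k) (f v)))))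
          residue : (toℕ v + f v) % a ≡ toℕ w % a
          residue = sym (trans (cong (_% a) (sym (+-identityʳ (toℕ w))))
                               (trans (cong (λ i → (toℕ w + i) % a) (sym (starts-arc i′ i′<fw (sym eq)))) eq))
          fw≤fv : f w ≤ f v
          fw≤fv = proj₂ (residue-gap (f v) (w≢v ∘ sym) 0<fv 0<fw residue)
          position : w ≡ vertex (toℕ v + f v) ⊎ w ≡ vertex (toℕ v + f v + a) → w ≡ vertex (toℕ v + f v + a)
          position (inj₁ w≡) = ⊥-elim (<-irrefl refl
            (<-walk-length (w≢v ∘ sym) 0<fv 0<fw (subst (λ t → Walk G v t (f v)) (sym w≡) (forward v (f v)))))
          position (inj₂ w≡) = w≡

      owner-bounded : ∀ {v} → 0 < f v → ∀ k {u} → Owns u (toℕ v + k) → f u ≤ f v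
      owner-bounded {v} 0<fv zero o = ≤-reflexive (cong f (owns-unique o (owns {index = 0} 0<fv refl)))
      owner-bounded {v} 0<fv (suc k) {u} o with covered (toℕ v + k)
      ... | u′ , owns {index = i} i<fu′ eq with suc i <? f u′
      ...   | yes 1+i<fu′ = ≤-trans (≤-reflexive (cong f (owns-unique o u′-owns)))
                                   (owner-bounded 0<fv k (owns i<fu′ eq))
        where
          u′-owns : Owns u′ (toℕ v + suc k)
          u′-owns = owns 1+i<fu′ (%-+-suc (toℕ u′) (toℕ v) i k a eq)
      ...   | no 1+i≮fu′ = ≤-trans (proj₁ (successor (≤-<-trans z≤n i<fu′) (owns-resp arc-end o)))
                                  (owner-bounded 0<fv k (owns i<fu′ eq))
        where
          arc-end : (toℕ v + suc k) % a ≡ (toℕ u′ + f u′) % a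
          arc-end = sym (trans (cong (λ j → (toℕ u′ + j) % a) (sym (≤-antisym i<fu′ (≮⇒≥ 1+i≮fu′))))
                               (%-+-suc (toℕ u′) (toℕ v) i k a eq))

      broadcast-≤ : ∀ {v w} → 0 < f v → 0 < f w → f w ≤ f v
      broadcast-≤ {v} {w} 0<fv 0<fw with offset v w
      ... | t , _ , arrive = owner-bounded 0<fv t (owns {index = 0} 0<fw (begin
          (toℕ w + 0) % a                  ≡⟨ cong (_% a) (+-identityʳ (toℕ w)) ⟩
          toℕ w % a                        ≡⟨ cong (λ u → toℕ u % a) (sym arrive) ⟩
          toℕ (vertex (toℕ v + t)) % a     ≡⟨ cong (_% a) (toℕ-vertex (toℕ v + t)) ⟩
          (toℕ v + t) % N % a              ≡⟨ %N%a (toℕ v + t) ⟩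
          (toℕ v + t) % a                  ∎))
        where open ≡-Reasoning

      v₀ : Fin N
      v₀ = proj₁ (covered 0)

      0<fv₀ : 0 < f v₀
      0<fv₀ = owns-broadcasting (proj₂ (covered 0))

      H : ℕ
      H = f v₀

      orbit : ℕ → Fin N
      orbit k = vertex (toℕ v₀ + k * (H + a))

      orbit-broadcasting : ∀ k → 0 < f (orbit k)
      orbit-broadcasting zero =
        subst (λ v → 0 < f v) (sym (trans (cong vertex (+-identityʳ (toℕ v₀))) (vertex-toℕ v₀))) 0<fv₀
      orbit-broadcasting (suc k) with covered (toℕ (orbit k) + f (orbit k))
      ... | w , o = subst (λ v → 0 < f v) w≡ (owns-broadcasting o)
        where
          open ≡-Reasoning
          x = toℕ v₀ + k * (H + a)
          fk≡H : f (orbit k) ≡ H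
          fk≡H = ≤-antisym (broadcast-≤ 0<fv₀ (orbit-broadcasting k)) (broadcast-≤ (orbit-broadcasting k) 0<fv₀)
          w≡ : w ≡ orbit (suc k)
          w≡ = begin
            w                                          ≡⟨ proj₂ (successor (orbit-broadcasting k) o) ⟩
            vertex (toℕ (orbit k) + f (orbit k) + a)   ≡⟨ cong (λ h → vertex (toℕ (orbit k) + h + a)) fk≡H ⟩
            vertex (toℕ (orbit k) + H + a)             ≡⟨ cong vertex (+-assoc (toℕ (orbit k)) H a) ⟩
            vertex (toℕ (vertex x) + (H + a))          ≡⟨ vertex-+ x (H + a) ⟩
            vertex (x + (H + a))                       ≡⟨ cong vertex (trans (+-assoc (toℕ v₀) _ _)
                                                            (cong (toℕ v₀ +_) (+-comm (k * (H + a)) (H + a)))) ⟩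
            orbit (suc k)                              ∎

      orbit-residue : ∀ k → a ∣ k * H → toℕ (orbit k) % a ≡ toℕ v₀ % a
      orbit-residue k a∣kH = begin
        toℕ (orbit k) % a                ≡⟨ cong (_% a) (toℕ-vertex x) ⟩
        x % N % a                        ≡⟨ %N%a x ⟩
        x % a                            ≡⟨ cong (_% a) (trans (cong (toℕ v₀ +_)
                                                                     (trans (*-distribˡ-+ k H a) (+-comm (k * H) (k * a))))
                                                               (sym (+-assoc (toℕ v₀) _ _))) ⟩
        (toℕ v₀ + k * a + k * H) % a     ≡⟨ %-remove-+ʳ (toℕ v₀ + k * a) a∣kH ⟩
        (toℕ v₀ + k * a) % a             ≡⟨ [m+kn]%n≡m%n (toℕ v₀) k a ⟩
        toℕ v₀ % a                       ∎
        where
          open ≡-Reasoning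
          x = toℕ v₀ + k * (H + a)

      closing : ∀ k → a ∣ k * H → N ∣ k * (H + a)
      closing k a∣kH with orbit k Fin.≟ v₀
      ... | no ≢v₀ = ⊥-elim (<⇒≱ (orbit-broadcasting k) (proj₁ (residue-gap 0 ≢v₀ (orbit-broadcasting k) 0<fv₀
                       (trans (cong (_% a) (+-identityʳ (toℕ (orbit k)))) (orbit-residue k a∣kH)))))
      ... | yes ≡v₀ = m%n≡0⇒n∣m _ N (%-cancelʳ-+ N (k * (H + a)) 0 (toℕ v₀) (begin
          (k * (H + a) + toℕ v₀) % N    ≡⟨ cong (_% N) (+-comm _ (toℕ v₀)) ⟩
          (toℕ v₀ + k * (H + a)) % N    ≡⟨ sym (toℕ-vertex (toℕ v₀ + k * (H + a))) ⟩
          toℕ (orbit k)                 ≡⟨ cong toℕ ≡v₀ ⟩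
          toℕ v₀                        ≡⟨ sym (m<n⇒m%n≡m (toℕ<n v₀)) ⟩
          toℕ v₀ % N                    ∎))
        where open ≡-Reasoning

    cost≢a-of-power-of-two : ∀ p → a ≡ 2 ^ p → cost f ≢ a
    cost≢a-of-power-of-two p a≡2^p tight =
      <⇒≱ (f<a v₀) (subst (_≤ H) (sym a≡2^p) (∣⇒≤ {{>-nonZero 0<fv₀}} (2^s∣H p H closing₂ p ≤-refl)))
      where
        open Tight tight
        closing₂ : ∀ k → 2 ^ p ∣ k * H → 2 * 2 ^ p ∣ k * (H + 2 ^ p)
        closing₂ k = subst (λ t → t ∣ k * H → 2 * t ∣ k * (H + t)) a≡2^p (closing k)

  shift-free⇒independent : ∀ {P : ℕ → Set} (P? : ∀ x → Dec (P x)) →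
    (∀ {s u v} → s ≡ 1 ⊎ s ≡ a → P (toℕ u) → P (toℕ v) → ¬ Shift N s u v) →
    IsIndependentSet G (subset P? N)
  shift-free⇒independent P? shift-free u v u∈ v∈ = no-edge
    where
      Pu = ∈-subset⁻ P? u∈
      Pv = ∈-subset⁻ P? v∈
      no-edge : ¬ G u v
      no-edge (inj₁ sh) = shift-free (inj₁ refl) Pu Pv sh
      no-edge (inj₂ (inj₁ sh)) = shift-free (inj₁ refl) Pv Pu sh
      no-edge (inj₂ (inj₂ (inj₁ sh))) = shift-free (inj₂ refl) Pu Pv sh
      no-edge (inj₂ (inj₂ (inj₂ sh))) = shift-free (inj₂ refl) Pv Pu sh

  shift-parity : ∀ {s u v} → Shift N s u v → parity (toℕ v) ≡ parity (toℕ u) ℙ.+ parity s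
  shift-parity {s} {u} (inj₁ eq) = trans (cong parity eq) (+-homo-+ (toℕ u) s)
  shift-parity {s} {u} {v} (inj₂ eq) = begin
    parity (toℕ v)                  ≡⟨ sym (+ℙ-identityʳ _) ⟩
    parity (toℕ v) ℙ.+ 0ℙ           ≡⟨ cong (parity (toℕ v) ℙ.+_) (sym (*-homo-* 2 a)) ⟩
    parity (toℕ v) ℙ.+ parity N     ≡⟨ sym (+-homo-+ (toℕ v) N) ⟩
    parity (toℕ v + N)              ≡⟨ cong parity eq ⟩
    parity (toℕ u + s)              ≡⟨ +-homo-+ (toℕ u) s ⟩
    parity (toℕ u) ℙ.+ parity s     ∎
    where open ≡-Reasoning

  module OddOrder (a-odd : parity a ≡ 1ℙ) where

    even? : ∀ x → Dec (parity x ≡ 0ℙ)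
    even? x = parity x ≟ℙ 0ℙ

    evens : Subset N
    evens = subset even? N

    evens-independent : IsIndependentSet G evens
    evens-independent = shift-free⇒independent even? λ {s} {u} {v} s∈ u-even v-even sh →
      0ℙ≢1ℙ (trans (sym v-even) (trans (shift-parity {s} {u} {v} sh) (cong₂ ℙ._+_ u-even (odd s∈))))
      where
        odd : ∀ {s} → s ≡ 1 ⊎ s ≡ a → parity s ≡ 1ℙ
        odd (inj₁ refl) = refl
        odd (inj₂ refl) = a-odd

    ∣evens∣ : ∣ evens ∣ ≡ a
    ∣evens∣ = begin
      ∣ evens ∣                                              ≡⟨ ∣subset∣ even? N ⟩
      ∑< N (χ ∘ even?)                                       ≡⟨ cong (λ n → ∑< n (χ ∘ even?)) N≡a+a ⟩
      ∑< (a + a) (χ ∘ even?)                                 ≡⟨ ∑<-halves a (χ ∘ even?) ⟩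
      ∑< a (λ i → χ (even? i) + χ (even? (a + i)))           ≡⟨ ∑<-cong a (λ i _ → χ-one (even? i) (even? (a + i))
                                                                                            (even⇒ i) (odd⇒ i)) ⟩
      ∑< a (λ _ → 1)                                         ≡⟨ ∑<-const a 1 ⟩
      a * 1                                                  ≡⟨ *-identityʳ a ⟩
      a                                                      ∎
      where
        open ≡-Reasoning
        flip : ∀ i → parity (a + i) ≡ parity i ⁻¹
        flip i = trans (+-homo-+ a i) (cong (ℙ._+ parity i) a-odd)
        even⇒ : ∀ i → parity i ≡ 0ℙ → parity (a + i) ≢ 0ℙ
        even⇒ i i-even a+i-even = 0ℙ≢1ℙ (trans (sym a+i-even) (trans (flip i) (cong _⁻¹ i-even)))
        odd⇒ : ∀ i → parity i ≢ 0ℙ → parity (a + i) ≡ 0ℙ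
        odd⇒ i i-odd = trans (flip i) (cong _⁻¹ (≢0ℙ⇒≡1ℙ i-odd))

  module EvenOrder (a-even : parity a ≡ 0ℙ) where

    half : ℕ → Parity
    half x with x <? a
    ... | yes _ = 0ℙ
    ... | no _ = 1ℙ

    half-< : ∀ {x} → x < a → half x ≡ 0ℙ
    half-< {x} x<a with x <? a
    ... | yes _ = refl
    ... | no x≮a = ⊥-elim (x≮a x<a)

    half-≥ : ∀ {x} → a ≤ x → half x ≡ 1ℙ
    half-≥ {x} a≤x with x <? a
    ... | yes x<a = ⊥-elim (<⇒≱ x<a a≤x)
    ... | no _ = refl

    -- The even vertices below a and the odd vertices in [a, 2a − 1).
    Balanced : ℕ → Set
    Balanced x = parity x ≡ half x × suc x < N

    balanced? : ∀ x → Dec (Balanced x)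
    balanced? x = (parity x ≟ℙ half x) ×-dec (suc x <? N)

    balanced : Subset N
    balanced = subset balanced? N

    parity-a+ : ∀ x → parity (a + x) ≡ parity x
    parity-a+ x = trans (+-homo-+ a x) (cong (ℙ._+ parity x) a-even)

    across-unbalanced : ∀ {x y} → y ≡ x + a → y < N → Balanced x → Balanced y → ⊥
    across-unbalanced {x} {y} refl y<N (x-bal , _) (y-bal , _) = 0ℙ≢1ℙ (begin
      0ℙ                ≡⟨ sym (half-< x<a) ⟩
      half x            ≡⟨ sym x-bal ⟩
      parity x          ≡⟨ sym (trans (cong parity (+-comm x a)) (parity-a+ x)) ⟩
      parity (x + a)    ≡⟨ y-bal ⟩
      half (x + a)      ≡⟨ half-≥ (m≤n+m a x) ⟩
      1ℙ                ∎)
      where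
        open ≡-Reasoning
        x<a : x < a
        x<a = +-cancelʳ-< a x a (subst (x + a <_) N≡a+a y<N)

    step-unbalanced : ∀ {x} → Balanced x → Balanced (x + 1) → ⊥
    step-unbalanced {x} (x-bal , _) (x+1-bal , _) with x + 1 ≟ a
    ... | yes x+1≡a =
      0ℙ≢1ℙ (trans (sym a-even) (trans (cong parity (sym x+1≡a)) (trans x+1-bal (half-≥ (≤-reflexive (sym x+1≡a))))))
    ... | no x+1≢a = p≢p⁻¹ (parity x) (begin
      parity x                ≡⟨ x-bal ⟩
      half x                  ≡⟨ same-half ⟩
      half (x + 1)            ≡⟨ sym x+1-bal ⟩
      parity (x + 1)          ≡⟨ +-homo-+ x 1 ⟩
      parity x ℙ.+ 1ℙ         ≡⟨ +ℙ-comm (parity x) 1ℙ ⟩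
      parity x ⁻¹             ∎)
      where
        open ≡-Reasoning
        same-half : half x ≡ half (x + 1)
        same-half with x <? a
        ... | yes x<a = sym (half-< (≤∧≢⇒< (subst (_≤ a) (+-comm 1 x) x<a) x+1≢a))
        ... | no x≮a = sym (half-≥ (≤-trans (≮⇒≥ x≮a) (m≤m+n x 1)))

    balanced-independent : IsIndependentSet G balanced
    balanced-independent = shift-free⇒independent balanced? no-shift
      where
        no-shift : ∀ {s u v} → s ≡ 1 ⊎ s ≡ a → Balanced (toℕ u) → Balanced (toℕ v) → ¬ Shift N s u v
        no-shift (inj₁ refl) u-bal v-bal (inj₁ v≡u+1) = step-unbalanced u-bal (subst Balanced v≡u+1 v-bal)
        no-shift {u = u} {v} (inj₁ refl) (_ , u+1<N) _ (inj₂ v+N≡u+1) =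
          <⇒≱ u+1<N (subst (N ≤_) (trans v+N≡u+1 (+-comm (toℕ u) 1)) (m≤n+m N (toℕ v)))
        no-shift {u = u} {v} (inj₂ refl) u-bal v-bal (inj₁ v≡u+a) = across-unbalanced v≡u+a (toℕ<n v) u-bal v-bal
        no-shift {u = u} {v} (inj₂ refl) u-bal v-bal (inj₂ v+N≡u+a) = across-unbalanced u≡v+a (toℕ<n u) v-bal u-bal
          where
            u≡v+a : toℕ u ≡ toℕ v + a
            u≡v+a = +-cancelʳ-≡ a (toℕ u) (toℕ v + a)
                      (trans (sym v+N≡u+a) (trans (cong (toℕ v +_) N≡a+a) (sym (+-assoc (toℕ v) a a))))

    balanced-in-pair : ℕ → ℕ
    balanced-in-pair i = χ (balanced? i) + χ (balanced? (a + i))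

    half-a+ : ∀ i → half (a + i) ≡ 1ℙ
    half-a+ i = half-≥ (m≤m+n a i)

    one-balanced-below-b : ∀ i → i < b → balanced-in-pair i ≡ 1
    one-balanced-below-b i i<b = χ-one (balanced? i) (balanced? (a + i)) lower⇒ ¬lower⇒
      where
        i<a : i < a
        i<a = <-trans i<b (n<1+n b)
        lower⇒ : Balanced i → ¬ Balanced (a + i)
        lower⇒ (i-bal , _) (a+i-bal , _) =
          0ℙ≢1ℙ (trans (sym (half-< i<a))
                  (trans (sym i-bal) (trans (sym (parity-a+ i)) (trans a+i-bal (half-a+ i)))))
        ¬lower⇒ : ¬ Balanced i → Balanced (a + i)
        ¬lower⇒ ¬i-bal = trans (parity-a+ i) (trans (≢0ℙ⇒≡1ℙ i-odd) (sym (half-a+ i))) ,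
                          subst (_< N) (+-suc a i) (subst (a + suc i <_) (sym N≡a+a) (+-monoʳ-< a (s≤s i<b)))
          where
            i-odd : parity i ≢ 0ℙ
            i-odd i-even = ¬i-bal (trans i-even (sym (half-< i<a)) , ≤-<-trans i<a a<N)

    none-balanced-at-b : balanced-in-pair (b + 0) ≡ 0
    none-balanced-at-b = χ-none (balanced? (b + 0)) (balanced? (a + (b + 0))) b-unbalanced a+b-unbalanced
      where
        b+0<a : b + 0 < a
        b+0<a = s≤s (≤-reflexive (+-identityʳ b))
        b-unbalanced : ¬ Balanced (b + 0)
        b-unbalanced (b-bal , _) = 0ℙ≢1ℙ (trans (sym (half-< b+0<a)) (trans (sym b-bal)
          (trans (cong parity (+-identityʳ b)) (trans (sym (suc-homo-⁻¹ b)) (cong _⁻¹ a-even)))))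
        a+b-unbalanced : ¬ Balanced (a + (b + 0))
        a+b-unbalanced (_ , last<N) =
          <-irrefl (trans (sym (+-suc a (b + 0))) (trans (cong (λ t → a + suc t) (+-identityʳ b)) (sym N≡a+a))) last<N

    ∣balanced∣ : ∣ balanced ∣ ≡ b
    ∣balanced∣ = begin
      ∣ balanced ∣                      ≡⟨ ∣subset∣ balanced? N ⟩
      ∑< N (χ ∘ balanced?)              ≡⟨ cong (λ n → ∑< n (χ ∘ balanced?)) N≡a+a ⟩
      ∑< (a + a) (χ ∘ balanced?)        ≡⟨ ∑<-halves a (χ ∘ balanced?) ⟩
      ∑< a balanced-in-pair                         ≡⟨ cong (λ n → ∑< n balanced-in-pair) (+-comm 1 b) ⟩
      ∑< (b + 1) balanced-in-pair                   ≡⟨ ∑<-+ b 1 balanced-in-pair ⟩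
      ∑< b balanced-in-pair + (balanced-in-pair (b + 0) + 0)    ≡⟨ cong₂ _+_ (∑<-cong b one-balanced-below-b) (cong (_+ 0) none-balanced-at-b) ⟩
      ∑< b (λ _ → 1) + 0                ≡⟨ +-identityʳ _ ⟩
      ∑< b (λ _ → 1)                    ≡⟨ ∑<-const b 1 ⟩
      b * 1                             ≡⟨ *-identityʳ b ⟩
      b                                 ∎
      where open ≡-Reasoning

  module Displacements where
    open import Data.Integer using (ℤ; +_; -_) renaming (_+_ to _+ℤ_; _-_ to _-ℤ_; _*_ to _*ℤ_; ∣_∣ to ∣_∣ℤ)
    open import Data.Integer.Properties using (pos-+; pos-*; ∣i+j∣≤∣i∣+∣j∣; ∣-i∣≡∣i∣; i-j≡0⇒i≡j)
      renaming (+-injective to pos-injective)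
    open import Data.Integer.Tactic.RingSolver using (solve-∀)
    open OddMultipleRigidity using (displacement-rigid; ∣m-n∣<o)

    record Displacement (x y : Fin N) (L : ℕ) : Set where
      constructor displacement
      field
        unit-steps : ℤ
        a-steps : ℕ
        turns : ℤ
        steps-bound : ∣ unit-steps ∣ℤ + a-steps ≤ L
        position : + toℕ y ≡ + toℕ x +ℤ unit-steps +ℤ + a-steps *ℤ + a +ℤ turns *ℤ + N

    +N≡+a+a : + N ≡ + a +ℤ + a
    +N≡+a+a = trans (cong +_ N≡a+a) (pos-+ a a)

    shift-turns : ∀ {s u v} → Shift N s u v → ∃ λ k → + toℕ v ≡ + toℕ u +ℤ + s +ℤ k *ℤ + N
    shift-turns {s} {u} {v} (inj₁ v≡u+s) =
      + 0 , trans (cong +_ v≡u+s) (trans (pos-+ (toℕ u) s) (no-turn (+ toℕ u) (+ s) (+ N)))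
      where
        no-turn : ∀ x y n → x +ℤ y ≡ x +ℤ y +ℤ + 0 *ℤ n
        no-turn = solve-∀
    shift-turns {s} {u} {v} (inj₂ v+N≡u+s) = - + 1 , (begin
      + toℕ v                            ≡⟨ back (+ toℕ v) (+ N) ⟩
      + toℕ v +ℤ + N -ℤ + N              ≡⟨ cong (λ z → z -ℤ + N) (sym (pos-+ (toℕ v) N)) ⟩
      + (toℕ v + N) -ℤ + N               ≡⟨ cong (λ z → + z -ℤ + N) v+N≡u+s ⟩
      + (toℕ u + s) -ℤ + N               ≡⟨ cong (λ z → z -ℤ + N) (pos-+ (toℕ u) s) ⟩
      + toℕ u +ℤ + s -ℤ + N              ≡⟨ turn (+ toℕ u) (+ s) (+ N) ⟩
      + toℕ u +ℤ + s +ℤ - + 1 *ℤ + N     ∎)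
      where
        open ≡-Reasoning
        back : ∀ v n → v ≡ v +ℤ n -ℤ n
        back = solve-∀
        turn : ∀ u s n → u +ℤ s -ℤ n ≡ u +ℤ s +ℤ - + 1 *ℤ n
        turn = solve-∀

    shift-displacement : ∀ {s u v} → s ≡ 1 ⊎ s ≡ a → Shift N s u v → Displacement u v 1
    shift-displacement {u = u} {v} (inj₁ refl) sh with shift-turns {1} {u} {v} sh
    ... | k , eq = displacement (+ 1) 0 k ≤-refl (trans eq (rearrange (+ toℕ u) k (+ a) (+ N)))
      where
        rearrange : ∀ u k a n → u +ℤ + 1 +ℤ k *ℤ n ≡ u +ℤ + 1 +ℤ + 0 *ℤ a +ℤ k *ℤ n
        rearrange = solve-∀
    shift-displacement {u = u} {v} (inj₂ refl) sh with shift-turns {a} {u} {v} sh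
    ... | k , eq = displacement (+ 0) 1 k ≤-refl (trans eq (rearrange (+ toℕ u) k (+ a) (+ N)))
      where
        rearrange : ∀ u k a n → u +ℤ a +ℤ k *ℤ n ≡ u +ℤ + 0 +ℤ + 1 *ℤ a +ℤ k *ℤ n
        rearrange = solve-∀

    displacement-sym : ∀ {x y L} → Displacement x y L → Displacement y x L
    displacement-sym {x} {y} (displacement s c k bound eq) =
      displacement (- s) c (- k -ℤ + c) (subst (λ t → t + c ≤ _) (sym (∣-i∣≡∣i∣ s)) bound) (begin
        + toℕ x                                              ≡⟨ solve-for (+ toℕ x) s (+ c *ℤ + a) (k *ℤ + N) ⟩
        + toℕ x +ℤ s +ℤ + c *ℤ + a +ℤ k *ℤ + N
          -ℤ s -ℤ + c *ℤ + a -ℤ k *ℤ + N                     ≡⟨ cong (λ z → z -ℤ s -ℤ + c *ℤ + a -ℤ k *ℤ + N) (sym eq) ⟩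
        + toℕ y -ℤ s -ℤ + c *ℤ + a -ℤ k *ℤ + N               ≡⟨ cong (λ n → + toℕ y -ℤ s -ℤ + c *ℤ + a -ℤ k *ℤ n) +N≡+a+a ⟩
        + toℕ y -ℤ s -ℤ + c *ℤ + a -ℤ k *ℤ (+ a +ℤ + a)      ≡⟨ turn (+ toℕ y) s (+ c) k (+ a) ⟩
        + toℕ y +ℤ - s +ℤ + c *ℤ + a +ℤ (- k -ℤ + c) *ℤ (+ a +ℤ + a)
                                                             ≡⟨ cong (λ n → + toℕ y +ℤ - s +ℤ + c *ℤ + a +ℤ (- k -ℤ + c) *ℤ n)
                                                                     (sym +N≡+a+a) ⟩
        + toℕ y +ℤ - s +ℤ + c *ℤ + a +ℤ (- k -ℤ + c) *ℤ + N  ∎)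
      where
        open ≡-Reasoning
        solve-for : ∀ x s A K → x ≡ x +ℤ s +ℤ A +ℤ K -ℤ s -ℤ A -ℤ K
        solve-for = solve-∀
        turn : ∀ y s c k a → y -ℤ s -ℤ c *ℤ a -ℤ k *ℤ (a +ℤ a) ≡ y +ℤ - s +ℤ c *ℤ a +ℤ (- k -ℤ c) *ℤ (a +ℤ a)
        turn = solve-∀

    edge-displacement : ∀ {u v} → G u v → Displacement u v 1
    edge-displacement (inj₁ sh) = shift-displacement (inj₁ refl) sh
    edge-displacement (inj₂ (inj₁ sh)) = displacement-sym (shift-displacement (inj₁ refl) sh)
    edge-displacement (inj₂ (inj₂ (inj₁ sh))) = shift-displacement (inj₂ refl) sh
    edge-displacement (inj₂ (inj₂ (inj₂ sh))) = displacement-sym (shift-displacement (inj₂ refl) sh)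

    walk-displacement : ∀ {x y L} → Walk G x y L → Displacement x y L
    walk-displacement {x} here = displacement (+ 0) 0 (+ 0) z≤n (stay (+ toℕ x) (+ a) (+ N))
      where
        stay : ∀ x a n → x ≡ x +ℤ + 0 +ℤ + 0 *ℤ a +ℤ + 0 *ℤ n
        stay = solve-∀
    walk-displacement {x} {y} (step {w = w} e p) with edge-displacement e | walk-displacement p
    ... | displacement s₁ c₁ k₁ bound₁ eq₁ | displacement s₂ c₂ k₂ bound₂ eq₂ =
      displacement (s₁ +ℤ s₂) (c₁ + c₂) (k₁ +ℤ k₂) bound (begin
        + toℕ y                                      ≡⟨ eq₂ ⟩
        + toℕ w +ℤ s₂ +ℤ + c₂ *ℤ + a +ℤ k₂ *ℤ + N     ≡⟨ cong (λ w → w +ℤ s₂ +ℤ + c₂ *ℤ + a +ℤ k₂ *ℤ + N) eq₁ ⟩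
        + toℕ x +ℤ s₁ +ℤ + c₁ *ℤ + a +ℤ k₁ *ℤ + N +ℤ s₂ +ℤ + c₂ *ℤ + a +ℤ k₂ *ℤ + N
                                                     ≡⟨ collect (+ toℕ x) s₁ s₂ (+ c₁) (+ c₂) k₁ k₂ (+ a) (+ N) ⟩
        + toℕ x +ℤ (s₁ +ℤ s₂) +ℤ (+ c₁ +ℤ + c₂) *ℤ + a +ℤ (k₁ +ℤ k₂) *ℤ + N
                                                     ≡⟨ cong (λ c → + toℕ x +ℤ (s₁ +ℤ s₂) +ℤ c *ℤ + a +ℤ (k₁ +ℤ k₂) *ℤ + N)
                                                             (sym (pos-+ c₁ c₂)) ⟩
        + toℕ x +ℤ (s₁ +ℤ s₂) +ℤ + (c₁ + c₂) *ℤ + a +ℤ (k₁ +ℤ k₂) *ℤ + N ∎)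
      where
        open ≡-Reasoning
        collect : ∀ x s₁ s₂ c₁ c₂ k₁ k₂ a n →
          x +ℤ s₁ +ℤ c₁ *ℤ a +ℤ k₁ *ℤ n +ℤ s₂ +ℤ c₂ *ℤ a +ℤ k₂ *ℤ n
            ≡ x +ℤ (s₁ +ℤ s₂) +ℤ (c₁ +ℤ c₂) *ℤ a +ℤ (k₁ +ℤ k₂) *ℤ n
        collect = solve-∀
        bound : ∣ s₁ +ℤ s₂ ∣ℤ + (c₁ + c₂) ≤ suc _
        bound = ≤-trans (+-monoˡ-≤ (c₁ + c₂) (∣i+j∣≤∣i∣+∣j∣ s₁ s₂))
                  (≤-trans (≤-reflexive (interchange ∣ s₁ ∣ℤ ∣ s₂ ∣ℤ c₁ c₂)) (+-mono-≤ bound₁ bound₂))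

    multiples-far-apart : ∀ {m H r q q′ x y L} → a ≡ m * H → m ≡ suc (2 * r) → 0 < H →
      toℕ x ≡ q * (2 * H) → toℕ y ≡ q′ * (2 * H) → q < m → q′ < m → Walk G x y L → L ≤ H → q ≡ q′
    multiples-far-apart {m} {H} {r} {q} {q′} {x} {y} a≡mH m≡ 0<H x≡ y≡ q<m q′<m p L≤H with walk-displacement p
    ... | displacement s c k bound eq = sym (pos-injective (i-j≡0⇒i≡j (+ q′) (+ q)
          (displacement-rigid r s (+ q′ -ℤ + q) k m≡ 0<H (∣m-n∣<o q′<m q<m) (≤-trans bound L≤H) scaled)))
      where
        open ≡-Reasoning
        as-ℤ : ∀ {z} n → z ≡ n * (2 * H) → + z ≡ + n *ℤ (+ 2 *ℤ + H)
        as-ℤ n refl = trans (pos-* n (2 * H)) (cong (+ n *ℤ_) (pos-* 2 H))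
        +a≡ : + a ≡ + m *ℤ + H
        +a≡ = trans (cong +_ a≡mH) (pos-* m H)
        distribute : ∀ q′ q h → + 2 *ℤ h *ℤ (q′ -ℤ q) ≡ q′ *ℤ (+ 2 *ℤ h) -ℤ q *ℤ (+ 2 *ℤ h)
        distribute = solve-∀
        cancel : ∀ x s c k → x +ℤ s +ℤ c +ℤ k -ℤ x ≡ s +ℤ c +ℤ k
        cancel = solve-∀
        scaled : + 2 *ℤ + H *ℤ (+ q′ -ℤ + q) ≡ s +ℤ + c *ℤ (+ m *ℤ + H) +ℤ k *ℤ (+ 2 *ℤ (+ m *ℤ + H))
        scaled = begin
          + 2 *ℤ + H *ℤ (+ q′ -ℤ + q)                             ≡⟨ distribute (+ q′) (+ q) (+ H) ⟩
          + q′ *ℤ (+ 2 *ℤ + H) -ℤ + q *ℤ (+ 2 *ℤ + H)             ≡⟨ cong₂ _-ℤ_ (sym (as-ℤ q′ y≡)) (sym (as-ℤ q x≡)) ⟩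
          + toℕ y -ℤ + toℕ x                                       ≡⟨ cong (_-ℤ + toℕ x) eq ⟩
          + toℕ x +ℤ s +ℤ + c *ℤ + a +ℤ k *ℤ + N -ℤ + toℕ x       ≡⟨ cancel (+ toℕ x) s (+ c *ℤ + a) (k *ℤ + N) ⟩
          s +ℤ + c *ℤ + a +ℤ k *ℤ + N                              ≡⟨ cong₂ (λ A M → s +ℤ + c *ℤ A +ℤ k *ℤ M) +a≡
                                                                           (trans (pos-* 2 a) (cong (+ 2 *ℤ_) +a≡)) ⟩
          s +ℤ + c *ℤ (+ m *ℤ + H) +ℤ k *ℤ (+ 2 *ℤ (+ m *ℤ + H))  ∎

  module OddFactor (m H r : ℕ) (a≡mH : a ≡ m * H) (m≡ : m ≡ suc (2 * r)) (1≤r : 1 ≤ r) (0<H : 0 < H) where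
    open Displacements using (multiples-far-apart)

    beacon : Fin N → ℕ
    beacon x = χ (2 * H ∣? toℕ x) * H

    N≡m*2H : N ≡ m * (2 * H)
    N≡m*2H = trans (cong (2 *_) a≡mH)
                   (trans (sym (*-assoc 2 m H)) (trans (cong (_* H) (*-comm 2 m)) (*-assoc m 2 H)))

    beacon-multiple : ∀ {x} → 0 < beacon x → 2 * H ∣ toℕ x
    beacon-multiple {x} 0<bx with 2 * H ∣? toℕ x
    ... | yes 2H∣x = 2H∣x
    ... | no _ = ⊥-elim (n≮0 0<bx)

    beacon-on-multiple : ∀ {x} → 2 * H ∣ toℕ x → beacon x ≡ H
    beacon-on-multiple {x} 2H∣x = trans (cong (_* H) (χ-yes (2 * H ∣? toℕ x) 2H∣x)) (+-identityʳ H)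

    index<m : ∀ {x} → 2 * H ∣ toℕ x → ∃ λ q → q < m × toℕ x ≡ q * (2 * H)
    index<m {x} (divides q x≡) = q , *-cancelʳ-< (2 * H) q m (subst₂ _<_ x≡ N≡m*2H (toℕ<n x)) , x≡

    beacons-far : ∀ {x y L} → x ≢ y → 0 < beacon x → 0 < beacon y → Walk G x y L → H < L
    beacons-far {x} {y} {L} x≢y 0<bx 0<by p with L ≤? H
    ... | no L≰H = ≰⇒> L≰H
    ... | yes L≤H with index<m (beacon-multiple 0<bx) | index<m (beacon-multiple 0<by)
    ...   | q , q<m , x≡ | q′ , q′<m , y≡ =
      ⊥-elim (x≢y (toℕ-injective (trans x≡ (trans (cong (_* (2 * H)) q≡q′) (sym y≡)))))
      where q≡q′ = multiples-far-apart {r = r} a≡mH m≡ 0<H x≡ y≡ q<m q′<m p L≤H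

    next : Fin N → Fin N
    next x = vertex (toℕ x + 2 * H)

    2H≤N : 2 * H ≤ N
    2H≤N = subst (2 * H ≤_) (sym N≡m*2H) (m≤n*m (2 * H) m {{subst NonZero (sym m≡) _}})

    next-beacon : ∀ {x} → 2 * H ∣ toℕ x → 2 * H ∣ toℕ (next x)
    next-beacon {x} 2H∣x = subst (2 * H ∣_) (sym (toℕ-vertex z))
      (∣m+n∣m⇒∣n (subst (2 * H ∣_) (trans (m≡m%n+[m/n]*n z N) (+-comm (z % N) _)) (∣m∣n⇒∣m+n 2H∣x n∣n))
                 (∣n⇒∣m*n (z / N) (divides m N≡m*2H)))
      where z = toℕ x + 2 * H

    next≢ : ∀ x → x ≢ next x
    next≢ x x≡next with %-below-double {n = N} (+-mono-<-≤ (toℕ<n x) 2H≤N)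
    ... | inj₁ no-wrap = <-irrefl (sym 2H≡0) (*-monoʳ-< 2 0<H)
      where
        2H≡0 : 2 * H ≡ 0
        2H≡0 = +-cancelˡ-≡ (toℕ x) (2 * H) 0 (trans (sym no-wrap)
                 (trans (sym (toℕ-vertex (toℕ x + 2 * H))) (trans (cong toℕ (sym x≡next)) (sym (+-identityʳ (toℕ x))))))
    ... | inj₂ wrap = <-irrefl (sym m≡1) (subst (1 <_) (sym m≡) (s≤s (≤-trans 1≤r (m≤m+n r (r + 0)))))
      where
        N≡2H : N ≡ 2 * H
        N≡2H = +-cancelˡ-≡ (toℕ x) N (2 * H)
                 (trans (cong (_+ N) (trans (cong toℕ x≡next) (toℕ-vertex (toℕ x + 2 * H)))) wrap)
        m≡1 : m ≡ 1
        m≡1 = *-cancelʳ-≡ m 1 (2 * H) {{>-nonZero (*-monoʳ-< 2 0<H)}}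
                (trans (sym N≡m*2H) (trans N≡2H (sym (*-identityˡ (2 * H)))))

    beacon-independent : IsIndependentBroadcast G beacon
    beacon-independent = broadcast , independent
      where
        beacon-positive : ∀ {x} → 2 * H ∣ toℕ x → 0 < beacon x
        beacon-positive 2H∣x = subst (0 <_) (sym (beacon-on-multiple 2H∣x)) 0<H
        broadcast : IsBroadcast G beacon
        broadcast x with 2 * H ∣? toℕ x
        ... | no _ = x , 0 , (here , λ _ ()) , z≤n
        ... | yes 2H∣x with shortest-walk edge? (2 * H) (forward x (2 * H))
        ...   | d , D , _ = next x , d , D , ≤-trans (≤-reflexive (*-identityˡ H)) (<⇒≤ H<d)
          where
            H<d = beacons-far (next≢ x) (beacon-positive 2H∣x) (beacon-positive (next-beacon 2H∣x)) (proj₁ D)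
        value : ∀ {x} → 0 < beacon x → beacon x ≡ H
        value = beacon-on-multiple ∘ beacon-multiple
        independent : ∀ u v → u ≢ v → 0 < beacon u → 0 < beacon v → ∀ d → Dist G u v d → beacon u ⊔ beacon v < d
        independent u v u≢v 0<bu 0<bv d (p , _) =
          subst (_< d) (sym (trans (cong₂ _⊔_ (value 0<bu) (value 0<bv)) (⊔-idem H))) (beacons-far u≢v 0<bu 0<bv p)

    cost-beacon : cost beacon ≡ a
    cost-beacon = begin
      cost beacon                                     ≡⟨ cost-toℕ N (λ z → χ (2 * H ∣? z) * H) ⟩
      ∑< N (λ z → χ (2 * H ∣? z) * H)                 ≡⟨ ∑<-*ʳ N (λ z → χ (2 * H ∣? z)) H ⟩
      ∑< N (λ z → χ (2 * H ∣? z)) * H                 ≡⟨ cong (λ n → ∑< n (λ z → χ (2 * H ∣? z)) * H) N≡m*2H ⟩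
      ∑< (m * (2 * H)) (λ z → χ (2 * H ∣? z)) * H     ≡⟨ cong (_* H) (∑<-multiples (2 * H) m (*-monoʳ-< 2 0<H)) ⟩
      m * H                                           ≡⟨ sym a≡mH ⟩
      a                                               ∎
      where open ≡-Reasoning

theorem4 : ∀ (a : ℕ) → 2 ≤ a →
    ((¬ (2 ∣ a)) →
      IndepNumber (Circ (2 * a) a) a × BroadcastIndepNumber (Circ (2 * a) a) a)
    × ((∃ λ p → 1 ≤ p × a ≡ 2 ^ p) →
      IndepNumber (Circ (2 * a) a) (a ∸ 1) × BroadcastIndepNumber (Circ (2 * a) a) (a ∸ 1))
    × (2 ∣ a → ¬ (∃ λ p → 1 ≤ p × a ≡ 2 ^ p) →
      BroadcastIndepNumber (Circ (2 * a) a) a)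
theorem4 (suc b) (s≤s 1≤b) = odd-order , power-of-two-order , other-order
  where
    open Circulant b

    cost≤a : ∀ f → IsIndependentBroadcast G f → cost f ≤ a
    cost≤a f ib = Broadcast.cost≤a 1≤b ib

    odd-order : ¬ (2 ∣ a) → IndepNumber G a × BroadcastIndepNumber G a
    odd-order 2∤a = α≡β-of-tight-independent-set neighbour evens evens-independent ∣evens∣ cost≤a
      where open OddOrder (≢0ℙ⇒≡1ℙ (2∤a ∘ even⇒2∣ a))

    power-of-two-order : (∃ λ p → 1 ≤ p × a ≡ 2 ^ p) → IndepNumber G b × BroadcastIndepNumber G b
    power-of-two-order (suc q , _ , a≡2^p) =
      α≡β-of-tight-independent-set neighbour balanced balanced-independent ∣balanced∣ cost≤b
      where
        open EvenOrder (trans (cong parity a≡2^p) (*-homo-* 2 (2 ^ q)))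
        cost≤b : ∀ f → IsIndependentBroadcast G f → cost f ≤ b
        cost≤b f ib = ≤-pred (≤∧≢⇒< (cost≤a f ib) (Broadcast.cost≢a-of-power-of-two 1≤b ib (suc q) a≡2^p))

    other-order : 2 ∣ a → ¬ (∃ λ p → 1 ≤ p × a ≡ 2 ^ p) → BroadcastIndepNumber G a
    other-order _ not-power with odd-factor a (s≤s 1≤b) not-power
    ... | m , H , r , a≡mH , m≡ , 1≤r , 0<H = (beacon , beacon-independent , cost-beacon) , cost≤a
      where open OddFactor m H r a≡mH m≡ 1≤r 0<H
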